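{- Let $A$ be a finite alphabet of colors and let $a_1,\dots,a_k\in A$. Then $$\mathfrak{S}_{(a_1,\dots,a_k)}=\sum_{J\succeq(a_1,\dots,a_k)}(-1)^{k-\ell(J)}H_J,$$ where the sum runs over all sentences $J$ that are coarsenings of the sentence $(a_1,\dots,a_k)$ of one-letter words.
   Context: Words are finite sequences of colors, $\cdot$ is concatenation; a sentence is a finite sequence $I=(w_1,\dots,w_k)$ of nonempty words; $\ell(I)=k$; $Q\preceq S$ ($S$ a coarsening of $Q$) means $S$ is obtained from $Q$ by concatenating adjacent words. Variables $x_{a,i}$ ($a\in A$, $i\ge1$) satisfy only $x_{a,i}x_{b,j}=x_{b,j}x_{a,i}$ for $i\ne j$; $x_{w,i}=x_{c_1,i}\cdots x_{c_r,i}$. $M_I=\sum_{j_1<\dots<j_k}x_{w_1,j_1}\cdots x_{w_k,j_k}$, $M_\emptyset=1$; $QSym_A=\mathrm{span}\{M_I\}$ with power-series product. $NSym_A$ is the free associative algebra on $H_w$ ($w$ nonempty words), $H_I=H_{w_1}\cdots H_{w_k}$; $\langle H_I,M_J\rangle=\delta_{I,J}$. For $M\in QSym_A$, $M^{\perp_r}$ is the linear map on $NSym_A$ with $\langle M^{\perp_r}(H),G\rangle=\langle H,GM\rangle$ for all $G$. For a nonempty word $v$, $\mathbb{B}_v(f)=\sum_u\sum_{Q}(-1)^{\ell(Q)}H_{(v\cdot u)}\big(\sum_{S\succeq Q}M^{\perp_r}_S(f)\big)$, $u$ over all words (empty $u$ giving only $Q=\emptyset$, $M^{\perp_r}_\emptyset=\mathrm{id}$),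 $Q=(q_1,\dots,q_i)$ over sentences with $q_i\cdots q_1=u$, $S$ over coarsenings of $Q$. The colored immaculate function of $J=(v_1,\dots,v_h)$ is $\mathfrak{S}_J=\mathbb{B}_{v_1}\cdots\mathbb{B}_{v_h}(1)$. -}

module Defs where

open import Data.Nat using (ℕ; zero; suc; _⊔_; _∸_)
open import Data.Integer using (ℤ; _^_; -_; _*_; _+_) renaming (+_ to ⁺)
open import Data.Fin using (Fin)
import Data.Fin as Fin
open import Data.Nat.ListAction using (sum)
open import Data.List using (List; []; _∷_; [_]; map; concatMap; concat; length; filterᵇ; null; foldr; upTo; allFin; reverse; _++_)
open import Data.List.Properties using (≡-dec)
open import Data.Product using (_×_; _,_; proj₁; proj₂)
open import Data.Bool using (Bool; not; _∧_; if_then_else_)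
open import Relation.Nullary using (does)

-- All enumerations below only produce sentences of nonempty words.

Word : ℕ → Set
Word n = List (Fin n)

Sentence : ℕ → Set
Sentence n = List (Word n)

module _ {n : ℕ} where

  _≟S_ : (I J : Sentence n) → Bool
  I ≟S J = does (≡-dec (≡-dec Fin._≟_) I J)

  -- |I| : total number of letters;  ℓ(I) is `length`
  size : Sentence n → ℕ
  size I = sum (map length I)

  wordsOfLength : ℕ → List (Word n)
  wordsOfLength zero    = [ [] ]
  wordsOfLength (suc L) = concatMap (λ a → map (a ∷_) (wordsOfLength L)) (allFin n)

compositions : {X : Set} → List X → List (List (List X))
compositions []       = [ [] ]
compositions (x ∷ xs) = concatMap step (compositions xs)
  where
  step : _ → _
  step []       = [ [ x ] ∷ [] ]
  step (p ∷ ps) = ([ x ] ∷ p ∷ ps) ∷ ((x ∷ p) ∷ ps) ∷ []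

module _ {n : ℕ} where

  coarsenings : Sentence n → List (Sentence n)
  coarsenings Q = map (map concat) (compositions Q)

  -- all sentences Q with q_i ⋯ q_1 = u
  revSentencesOf : Word n → List (Sentence n)
  revSentencesOf u = map reverse (compositions u)

  sentencesUpTo : ℕ → List (Sentence n)
  sentencesUpTo N = concatMap (λ L → concatMap compositions (wordsOfLength L)) (upTo (suc N))

-- A monomial in the x_{a,i} (partially commutative) has the normal form
-- x_{w_1,1} x_{w_2,2} ⋯ (w_i the, possibly empty, word carried by index i);
-- products of monomials are index-wise concatenations.  M_I is the sum of
-- the monomials whose nonempty index-words, read in index order, form I.
-- The coefficient of M_K in a quasisymmetric series is the coefficient of
-- the monomial x_{k_1,1} ⋯ x_{k_m,m}.  Hence the coefficient of M_K in
-- M_J M_S counts the ways of writing each k_p = x_p · y_p such that the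
-- nonempty x's form J and the nonempty y's form S.

splits : {X : Set} → List X → List (List X × List X)
splits []       = ([] , []) ∷ []
splits (x ∷ xs) = ([] , x ∷ xs) ∷ map (λ p → (x ∷ proj₁ p , proj₂ p)) (splits xs)

allSplits : {X : Set} → List (List X) → List (List (List X × List X))
allSplits []       = [ [] ]
allSplits (w ∷ ws) = concatMap (λ p → map (p ∷_) (allSplits ws)) (splits w)

module _ {n : ℕ} where

  nonemptyParts : List (Word n) → Sentence n
  nonemptyParts = filterᵇ (λ w → not (null w))

  prodCoeff : (K J S : Sentence n) → ℕ
  prodCoeff K J S =
    length (filterᵇ (λ σ → (nonemptyParts (map proj₁ σ) ≟S J)
                          ∧ (nonemptyParts (map proj₂ σ) ≟S S))
                    (allSplits K))

-- NSym_A : finite formal ℤ-combinations of the basis H_I.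

NSym : ℕ → Set
NSym n = List (ℤ × Sentence n)

module _ {n : ℕ} where

  coeff : NSym n → Sentence n → ℤ
  coeff f K = sum' f
    where
    sum' : NSym n → ℤ
    sum' []             = ⁺ 0
    sum' ((c , I) ∷ fs) = (if I ≟S K then c else ⁺ 0) + sum' fs

  one : NSym n
  one = (⁺ 1 , []) ∷ []

  scale : ℤ → NSym n → NSym n
  scale c = map (λ t → (c * proj₁ t , proj₂ t))

  -- left multiplication by H_w
  Hmul : Word n → NSym n → NSym n
  Hmul w = map (λ t → (proj₁ t , w ∷ proj₂ t))

  -- upper bound for the degree of f
  deg : NSym n → ℕ
  deg = foldr (λ t d → size (proj₂ t) ⊔ d) 0

  -- M_S^{⊥_r}:  M_S^⊥(H_I) = Σ_J ⟨H_I, M_J M_S⟩ H_J.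
  -- Only J with |J| ≤ |I| can contribute, so J runs over sentencesUpTo |I|.
  Mperp : Sentence n → NSym n → NSym n
  Mperp S = concatMap (λ t → map (λ J → (proj₁ t * ⁺ (prodCoeff (proj₂ t) J S) , J))
                                 (sentencesUpTo (size (proj₂ t))))

  -- The sum over all words u is restricted to
  -- |u| ≤ deg f, as all terms with |u| > deg f vanish (M_S^⊥ lowers degree by |S| = |u|).
  -- For u empty the only Q is ∅, with only coarsening ∅, and M_∅^⊥ = id.
  𝔹 : Word n → NSym n → NSym n
  𝔹 v f =
    concatMap (λ L →
      concatMap (λ u →
        concatMap (λ Q →
          scale ((- ⁺ 1) ^ length Q)
            (Hmul (v ++ u) (concatMap (λ S → Mperp S f) (coarsenings Q))))
          (revSentencesOf u))
        (wordsOfLength L))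
      (upTo (suc (deg f)))

  immaculate : Sentence n → NSym n
  immaculate J = foldr 𝔹 one J

  letters : List (Fin n) → Sentence n
  letters as = map [_] as

-- By induction on k, using 𝔖_(a_1,…,a_k) = 𝔹_(a_1) 𝔖_(a_2,…,a_k).  The operator 𝔹_a acts on H-coefficients
-- through a matrix, so only its entries on the sentences J ⪰ (a_2,…,a_k) matter.  Unfolding 𝔹_a, the entry at
-- K = (c·u, K′) is [a = c] times a signed sum over Q, S ⪰ Q and compositions I of ⟨H_I, M_K′ M_S⟩.  Summed with
-- sign (-1)^ℓ(I) over the compositions I of a fixed word w, these coefficients cancel except when all blocks of S
-- precede all blocks of K′:  Σ_I (-1)^ℓ(I) ⟨H_I, M_K′ M_S⟩ = (-1)^(ℓ(S)+ℓ(K′)) [w = concat S · concat K′].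
-- This is proved by peeling off the first letter of w, which transforms a triple of weight functions.  Finally
-- Σ_(S ⪰ Q) (-1)^ℓ(S) vanishes unless Q has at most one word, which leaves exactly the terms of the claimed sum.

module Submission where

open import Data.Bool using (Bool; true; false; not; _∧_; if_then_else_; T)
open import Data.Bool.Properties using (∧-zeroʳ)
open import Data.Empty using (⊥-elim)
open import Data.Fin using (Fin)
import Data.Fin as Fin
open import Data.Integer using (ℤ; _+_; _*_; -_; _^_; 0ℤ; 1ℤ; -1ℤ) renaming (+_ to ⁺)
import Data.Integer.Properties as ℤP
open import Data.Integer.Tactic.RingSolver using (solve-∀)
open import Data.List
  using (List; []; _∷_; [_]; _++_; map; length; concatMap; concat; filterᵇ; null; upTo; allFin; reverse; tabulate; applyUpTo; deduplicate)
import Data.List.Properties as LP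
open import Data.List.Membership.Propositional using (_∈_; _∉_)
open import Data.List.Membership.Propositional.Properties using (∈-deduplicate⁺; ∈-++⁺ˡ; ∈-++⁺ʳ; ∈-map⁺)
open import Data.List.Relation.Unary.All as All using (All; []; _∷_)
import Data.List.Relation.Unary.All.Properties as AllP
open import Data.List.Relation.Unary.AllPairs using (_∷_)
open import Data.List.Relation.Unary.Any as Any using (Any; here; there)
import Data.List.Relation.Unary.Any.Properties as AnyP
open import Data.List.Relation.Unary.Unique.Propositional using (Unique)
open import Data.List.Relation.Unary.Unique.DecPropositional.Properties using (deduplicate-!)
open import Data.Maybe using (Maybe; just; nothing)
open import Data.Nat as ℕ using (ℕ; zero; suc; _∸_; _≡ᵇ_; _<ᵇ_) renaming (_+_ to _+ℕ_; _≤_ to _≤ℕ_)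
import Data.Nat.Properties as ℕP
open import Data.Product using (_×_; _,_; proj₁; proj₂)
open import Data.Unit using (tt)
open import Function using (_∘_)
open import Relation.Binary.Definitions using (DecidableEquality)
open import Relation.Binary.PropositionalEquality using (_≡_; _≢_; refl; sym; trans; cong; cong₂; subst; module ≡-Reasoning)
open import Relation.Nullary using (does; yes; no)
open import Algebra.Properties.CommutativeSemigroup ℤP.*-commutativeSemigroup using (x∙yz≈y∙xz)

open import Defs

∑ : {X : Set} → List X → (X → ℤ) → ℤ
∑ []       f = 0ℤ
∑ (x ∷ xs) f = f x + ∑ xs f

module _ {X : Set} where

  ∑-cong : (xs : List X) {f g : X → ℤ} → (∀ x → f x ≡ g x) → ∑ xs f ≡ ∑ xs g
  ∑-cong []       e = refl
  ∑-cong (x ∷ xs) e = cong₂ _+_ (e x) (∑-cong xs e)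

  ∑-cong-All : {xs : List X} {f g : X → ℤ} → All (λ x → f x ≡ g x) xs → ∑ xs f ≡ ∑ xs g
  ∑-cong-All []       = refl
  ∑-cong-All (e ∷ es) = cong₂ _+_ e (∑-cong-All es)

  ∑-++ : (xs ys : List X) (f : X → ℤ) → ∑ (xs ++ ys) f ≡ ∑ xs f + ∑ ys f
  ∑-++ []       ys f = sym (ℤP.+-identityˡ _)
  ∑-++ (x ∷ xs) ys f = trans (cong (f x +_) (∑-++ xs ys f)) (sym (ℤP.+-assoc (f x) _ _))

  ∑-zero : (xs : List X) → ∑ xs (λ _ → 0ℤ) ≡ 0ℤ
  ∑-zero []       = refl
  ∑-zero (x ∷ xs) = trans (ℤP.+-identityˡ _) (∑-zero xs)

  ∑-vanishes : (xs : List X) (f : X → ℤ) → (∀ x → f x ≡ 0ℤ) → ∑ xs f ≡ 0ℤ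
  ∑-vanishes xs f e = trans (∑-cong xs e) (∑-zero xs)

  ∑-+ : (xs : List X) (f g : X → ℤ) → ∑ xs (λ x → f x + g x) ≡ ∑ xs f + ∑ xs g
  ∑-+ []       f g = refl
  ∑-+ (x ∷ xs) f g = trans (cong (f x + g x +_) (∑-+ xs f g)) (interchange (f x) (g x) (∑ xs f) (∑ xs g))
    where
    interchange : ∀ a b c d → a + b + (c + d) ≡ a + c + (b + d)
    interchange = solve-∀

  ∑-*ˡ : (xs : List X) (c : ℤ) (f : X → ℤ) → ∑ xs (λ x → c * f x) ≡ c * ∑ xs f
  ∑-*ˡ []       c f = sym (ℤP.*-zeroʳ c)
  ∑-*ˡ (x ∷ xs) c f = trans (cong (c * f x +_) (∑-*ˡ xs c f)) (sym (ℤP.*-distribˡ-+ c (f x) _))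

  ∑-*ʳ : (xs : List X) (c : ℤ) (f : X → ℤ) → ∑ xs (λ x → f x * c) ≡ ∑ xs f * c
  ∑-*ʳ xs c f = trans (∑-cong xs (λ x → ℤP.*-comm (f x) c)) (trans (∑-*ˡ xs c f) (ℤP.*-comm c _))

  ∑-neg : (xs : List X) (f : X → ℤ) → ∑ xs (λ x → - f x) ≡ - ∑ xs f
  ∑-neg []       f = refl
  ∑-neg (x ∷ xs) f = trans (cong (- f x +_) (∑-neg xs f)) (sym (ℤP.neg-distrib-+ (f x) _))

module _ {X Y : Set} where

  ∑-map : (g : X → Y) (xs : List X) (f : Y → ℤ) → ∑ (map g xs) f ≡ ∑ xs (f ∘ g)
  ∑-map g []       f = refl
  ∑-map g (x ∷ xs) f = cong (f (g x) +_) (∑-map g xs f)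

  ∑-concatMap : (g : X → List Y) (xs : List X) (f : Y → ℤ) →
    ∑ (concatMap g xs) f ≡ ∑ xs (λ x → ∑ (g x) f)
  ∑-concatMap g []       f = refl
  ∑-concatMap g (x ∷ xs) f = trans (∑-++ (g x) (concatMap g xs) f) (cong (∑ (g x) f +_) (∑-concatMap g xs f))

  ∑-swap : (xs : List X) (ys : List Y) (f : X → Y → ℤ) →
    ∑ xs (λ x → ∑ ys (f x)) ≡ ∑ ys (λ y → ∑ xs (λ x → f x y))
  ∑-swap []       ys f = sym (∑-zero ys)
  ∑-swap (x ∷ xs) ys f = trans (cong (∑ ys (f x) +_) (∑-swap xs ys f)) (sym (∑-+ ys (f x) _))

  ∑-swap-*ˡ : (xs : List X) (ys : List Y) (c : Y → ℤ) (f : X → Y → ℤ) →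
    ∑ xs (λ x → ∑ ys (λ y → c y * f x y)) ≡ ∑ ys (λ y → c y * ∑ xs (λ x → f x y))
  ∑-swap-*ˡ xs ys c f = trans (∑-swap xs ys (λ x y → c y * f x y)) (∑-cong ys (λ y → ∑-*ˡ xs (c y) (λ x → f x y)))

  ∑-*-swap : (xs : List X) (ys : List Y) (a : X → ℤ) (c : Y → ℤ) (f : X → Y → ℤ) →
    ∑ xs (λ x → a x * ∑ ys (λ y → c y * f x y)) ≡ ∑ ys (λ y → c y * ∑ xs (λ x → a x * f x y))
  ∑-*-swap xs ys a c f = begin
    ∑ xs (λ x → a x * ∑ ys (λ y → c y * f x y))     ≡⟨ ∑-cong xs (λ x → ∑-*ˡ ys (a x) (λ y → c y * f x y)) ⟨
    ∑ xs (λ x → ∑ ys (λ y → a x * (c y * f x y)))   ≡⟨ ∑-cong xs (λ x → ∑-cong ys (λ y → x∙yz≈y∙xz (a x) (c y) (f x y))) ⟩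
    ∑ xs (λ x → ∑ ys (λ y → c y * (a x * f x y)))   ≡⟨ ∑-swap-*ˡ xs ys c (λ x y → a x * f x y) ⟩
    ∑ ys (λ y → c y * ∑ xs (λ x → a x * f x y))     ∎
    where
    open ≡-Reasoning

  ∑-*-∑ : (xs : List X) (ys : List Y) (a : X → ℤ) (f : X → Y → ℤ) →
    ∑ xs (λ x → a x * ∑ ys (f x)) ≡ ∑ ys (λ y → ∑ xs (λ x → a x * f x y))
  ∑-*-∑ xs ys a f = trans (∑-cong xs (λ x → sym (∑-*ˡ ys (a x) (f x)))) (∑-swap xs ys (λ x y → a x * f x y))

∑-∑-*ˡ : {X Y : Set} (xs : List X) (ys : X → List Y) (a : X → ℤ) (c : ℤ) (f : Y → ℤ) →
  ∑ xs (λ x → a x * ∑ (ys x) (λ y → c * f y)) ≡ c * ∑ xs (λ x → a x * ∑ (ys x) f)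
∑-∑-*ˡ xs ys a c f = trans (∑-cong xs (λ x → trans (cong (a x *_) (∑-*ˡ (ys x) c f)) (x∙yz≈y∙xz (a x) c _))) (∑-*ˡ xs c _)

𝟙 : Bool → ℤ
𝟙 true  = 1ℤ
𝟙 false = 0ℤ

𝟙-∧ : ∀ a b → 𝟙 (a ∧ b) ≡ 𝟙 a * 𝟙 b
𝟙-∧ true  b = sym (ℤP.*-identityˡ (𝟙 b))
𝟙-∧ false b = refl

𝟙-T : ∀ {b} → T b → 𝟙 b ≡ 1ℤ
𝟙-T {true} _ = refl

𝟙-guard : ∀ b {x y} → (T b → x ≡ y) → 𝟙 b * x ≡ 𝟙 b * y
𝟙-guard true  x≡y = cong (1ℤ *_) (x≡y tt)
𝟙-guard false x≡y = refl

onlyIf : Bool → ℤ → ℤ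
onlyIf b x = if b then x else 0ℤ

onlyIf-𝟙 : ∀ b x → onlyIf b x ≡ 𝟙 b * x
onlyIf-𝟙 true  x = sym (ℤP.*-identityˡ x)
onlyIf-𝟙 false x = refl

onlyIf-* : ∀ b c x → onlyIf b (c * x) ≡ c * onlyIf b x
onlyIf-* true  c x = refl
onlyIf-* false c x = sym (ℤP.*-zeroʳ c)

onlyIf-∧ : ∀ a b x → onlyIf (a ∧ b) x ≡ onlyIf a (onlyIf b x)
onlyIf-∧ true  b x = refl
onlyIf-∧ false b x = refl

∑-onlyIf : {X : Set} (xs : List X) (b : Bool) (f : X → ℤ) → ∑ xs (λ x → onlyIf b (f x)) ≡ onlyIf b (∑ xs f)
∑-onlyIf xs true  f = refl
∑-onlyIf xs false f = ∑-zero xs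

𝟙-length-filterᵇ : {X : Set} (p : X → Bool) (xs : List X) → ⁺ (length (filterᵇ p xs)) ≡ ∑ xs (𝟙 ∘ p)
𝟙-length-filterᵇ p []       = refl
𝟙-length-filterᵇ p (x ∷ xs) with p x
... | true  = cong (1ℤ +_) (𝟙-length-filterᵇ p xs)
... | false = trans (𝟙-length-filterᵇ p xs) (sym (ℤP.+-identityˡ _))

sgn : ℕ → ℤ
sgn k = (- ⁺ 1) ^ k

sgn-+ : ∀ a b → sgn (a +ℕ b) ≡ sgn a * sgn b
sgn-+ = ℤP.^-distribˡ-+-* (- ⁺ 1)

sgn-sq : ∀ m → sgn m * sgn m ≡ 1ℤ
sgn-sq zero    = refl
sgn-sq (suc m) = trans (neg-sq (sgn m)) (sgn-sq m)
  where
  neg-sq : ∀ s → (-1ℤ * s) * (-1ℤ * s) ≡ s * s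
  neg-sq = solve-∀

sgn-∸ : ∀ k m → m ≤ℕ k → sgn (k ∸ m) ≡ sgn k * sgn m
sgn-∸ k m m≤k = begin
  sgn (k ∸ m)                   ≡⟨ sym (ℤP.*-identityʳ _) ⟩
  sgn (k ∸ m) * 1ℤ              ≡⟨ cong (sgn (k ∸ m) *_) (sym (sgn-sq m)) ⟩
  sgn (k ∸ m) * (sgn m * sgn m) ≡⟨ sym (ℤP.*-assoc (sgn (k ∸ m)) (sgn m) (sgn m)) ⟩
  sgn (k ∸ m) * sgn m * sgn m   ≡⟨ cong (_* sgn m) (sym (sgn-+ (k ∸ m) m)) ⟩
  sgn (k ∸ m +ℕ m) * sgn m      ≡⟨ cong (λ z → sgn z * sgn m) (ℕP.m∸n+n≡m m≤k) ⟩
  sgn k * sgn m                 ∎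
  where open ≡-Reasoning

module Counting {X : Set} (_≟_ : DecidableEquality X) where

  count : List X → X → ℤ
  count xs k = ∑ xs (λ x → 𝟙 (does (x ≟ k)))

  does-≟-sym : ∀ x y → does (x ≟ y) ≡ does (y ≟ x)
  does-≟-sym x y with x ≟ y | y ≟ x
  ... | yes _   | yes _   = refl
  ... | no _    | no _    = refl
  ... | yes x≡y | no y≢x  = ⊥-elim (y≢x (sym x≡y))
  ... | no x≢y  | yes y≡x = ⊥-elim (x≢y (sym y≡x))

  ∑-𝟙-≟ : ∀ (xs : List X) k (h : X → ℤ) → ∑ xs (λ x → 𝟙 (does (x ≟ k)) * h x) ≡ count xs k * h k
  ∑-𝟙-≟ xs k h = trans (∑-cong xs at-k) (∑-*ʳ xs (h k) (λ x → 𝟙 (does (x ≟ k))))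
    where
    at-k : ∀ x → 𝟙 (does (x ≟ k)) * h x ≡ 𝟙 (does (x ≟ k)) * h k
    at-k x with x ≟ k
    ... | yes refl = refl
    ... | no _     = refl

  count≢0⇒∈ : ∀ xs k → count xs k ≢ 0ℤ → k ∈ xs
  count≢0⇒∈ []       k ≢0 = ⊥-elim (≢0 refl)
  count≢0⇒∈ (x ∷ xs) k ≢0 with x ≟ k
  ... | yes x≡k = here (sym x≡k)
  ... | no _    = there (count≢0⇒∈ xs k (≢0 ∘ trans (ℤP.+-identityˡ (count xs k))))

  count-∉ : ∀ {xs k} → k ∉ xs → count xs k ≡ 0ℤ
  count-∉ {[]}     k∉xs = refl
  count-∉ {x ∷ xs} {k} k∉xs with x ≟ k
  ... | yes refl = ⊥-elim (k∉xs (here refl))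
  ... | no _     = trans (ℤP.+-identityˡ _) (count-∉ (k∉xs ∘ there))

  count-unique : ∀ {xs k} → Unique xs → k ∈ xs → count xs k ≡ 1ℤ
  count-unique {x ∷ xs} {k} (x∉xs ∷ !xs) k∈ with x ≟ k | k∈
  ... | yes refl | _          = cong (1ℤ +_) (count-∉ (λ x∈xs → All.lookup x∉xs x∈xs refl))
  ... | no x≢k   | here k≡x   = ⊥-elim (x≢k (sym k≡x))
  ... | no _     | there k∈xs = trans (ℤP.+-identityˡ _) (count-unique !xs k∈xs)

ι : ℕ → ℤ
ι zero          = 1ℤ
ι (suc zero)    = -1ℤ
ι (suc (suc _)) = 0ℤ

module _ {X : Set} where

  attach : X → List (List X) → List (List (List X))
  attach x []       = [ [ x ] ∷ [] ]
  attach x (p ∷ ps) = ([ x ] ∷ p ∷ ps) ∷ ((x ∷ p) ∷ ps) ∷ []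

  compositions-∷ : (x : X) (xs : List X) → compositions (x ∷ xs) ≡ concatMap (attach x) (compositions xs)
  compositions-∷ x xs = LP.concatMap-cong (λ { [] → refl ; (p ∷ ps) → refl }) (compositions xs)

  ∑-compositions-∷ : (x : X) (xs : List X) (f : List (List X) → ℤ) →
    ∑ (compositions (x ∷ xs)) f ≡ ∑ (compositions xs) (λ C → ∑ (attach x C) f)
  ∑-compositions-∷ x xs f = trans (cong (λ l → ∑ l f) (compositions-∷ x xs)) (∑-concatMap (attach x) (compositions xs) f)

  allNonempty : List (List X) → Bool
  allNonempty []       = true
  allNonempty (w ∷ ws) = not (null w) ∧ allNonempty ws

  IsComposition : List X → List (List X) → Set
  IsComposition xs C = (concat C ≡ xs) × T (allNonempty C)

  compositions-sound : (xs : List X) → All (IsComposition xs) (compositions xs)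
  compositions-sound []       = (refl , tt) ∷ []
  compositions-sound (x ∷ xs) = subst (All (IsComposition (x ∷ xs))) (sym (compositions-∷ x xs))
    (AllP.concat⁺ (AllP.map⁺ (All.map attach-sound (compositions-sound xs))))
    where
    attach-sound : ∀ {C} → IsComposition xs C → All (IsComposition (x ∷ xs)) (attach x C)
    attach-sound {[]}     (e , t) = (cong (x ∷_) e , tt) ∷ []
    attach-sound {p ∷ ps} (e , t) = (cong (x ∷_) e , t) ∷ (cong (x ∷_) e , T-∧ʳ t) ∷ []
      where
      T-∧ʳ : ∀ {a b} → T (a ∧ b) → T b
      T-∧ʳ {true} t = t

  compositions-∷-nonempty : (x : X) (xs : List X) → All (_≢ []) (compositions (x ∷ xs))
  compositions-∷-nonempty x xs = All.map (λ { {[]} (() , _) ; {_ ∷ _} _ () }) (compositions-sound (x ∷ xs))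

  ∑-compositions-sound : (xs : List X) {f g : List (List X) → ℤ} →
    (∀ C → IsComposition xs C → f C ≡ g C) → ∑ (compositions xs) f ≡ ∑ (compositions xs) g
  ∑-compositions-sound xs e = ∑-cong-All (All.map (e _) (compositions-sound xs))

  length≤length-concat : (C : List (List X)) → T (allNonempty C) → length C ≤ℕ length (concat C)
  length≤length-concat []             t = ℕ.z≤n
  length≤length-concat ((x ∷ w) ∷ ws) t =
    ℕ.s≤s (ℕP.≤-trans (length≤length-concat ws t) (subst (length (concat ws) ≤ℕ_) (sym (LP.length-++ w)) (ℕP.m≤n+m _ (length w))))

  ∑-sgn-compositions : (xs : List X) → ∑ (compositions xs) (sgn ∘ length) ≡ ι (length xs)
  ∑-sgn-compositions []           = refl
  ∑-sgn-compositions (x ∷ [])     = refl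
  ∑-sgn-compositions (x ∷ y ∷ ys) = trans (∑-compositions-∷ x (y ∷ ys) (sgn ∘ length))
    (pairs-cancel (compositions-∷-nonempty y ys))
    where
    cancels : ∀ s → -1ℤ * (-1ℤ * s) + (-1ℤ * s + 0ℤ) ≡ 0ℤ
    cancels = solve-∀
    pairs-cancel : ∀ {Cs} → All (_≢ []) Cs → ∑ Cs (λ C → ∑ (attach x C) (sgn ∘ length)) ≡ 0ℤ
    pairs-cancel {Cs} ne = trans (∑-cong-All (All.map (λ { {[]} ne → ⊥-elim (ne refl) ; {p ∷ ps} _ → cancels (sgn (length ps)) }) ne)) (∑-zero Cs)

  atMostOneBlock : List X → List (List X)
  atMostOneBlock []       = []
  atMostOneBlock (x ∷ xs) = (x ∷ xs) ∷ []

  ∑-compositions-atMostOneBlock : (xs : List X) (ψ : List (List X) → ℤ) → (∀ c₁ c₂ cs → ψ (c₁ ∷ c₂ ∷ cs) ≡ 0ℤ) →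
    ∑ (compositions xs) ψ ≡ ψ (atMostOneBlock xs)
  ∑-compositions-atMostOneBlock []       ψ v = ℤP.+-identityʳ _
  ∑-compositions-atMostOneBlock (x ∷ xs) ψ v =
    trans (∑-compositions-∷ x xs ψ) (trans (∑-compositions-atMostOneBlock xs ψ′ v′) (attach-atMostOneBlock xs))
    where
    ψ′ : List (List X) → ℤ
    ψ′ C = ∑ (attach x C) ψ
    v′ : ∀ c₁ c₂ cs → ψ′ (c₁ ∷ c₂ ∷ cs) ≡ 0ℤ
    v′ c₁ c₂ cs = cong₂ _+_ (v [ x ] c₁ (c₂ ∷ cs)) (cong (_+ 0ℤ) (v (x ∷ c₁) c₂ cs))
    attach-atMostOneBlock : ∀ xs → ψ′ (atMostOneBlock xs) ≡ ψ (atMostOneBlock (x ∷ xs))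
    attach-atMostOneBlock []       = ℤP.+-identityʳ _
    attach-atMostOneBlock (y ∷ ys) =
      trans (cong (_+ (ψ ((x ∷ y ∷ ys) ∷ []) + 0ℤ)) (v [ x ] (y ∷ ys) [])) (trans (ℤP.+-identityˡ _) (ℤP.+-identityʳ _))

module CountCompositions {X : Set} (_≟_ : DecidableEquality X) where

  _≟L_ : DecidableEquality (List X)
  _≟L_ = LP.≡-dec _≟_

  open Counting (LP.≡-dec _≟L_) using (count)

  unprefix : X → List (List X) → Maybe (List (List X))
  unprefix x []                 = nothing
  unprefix x ([] ∷ J)           = nothing
  unprefix x ((y ∷ []) ∷ J)     = if does (x ≟ y) then just J else nothing
  unprefix x ((y ∷ z ∷ w) ∷ J)  = if does (x ≟ y) then just ((z ∷ w) ∷ J) else nothing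

  matches : Maybe (List (List X)) → List (List X) → ℤ
  matches nothing  C = 0ℤ
  matches (just D) C = 𝟙 (does (LP.≡-dec _≟L_ C D))

  count-attach : (x : X) (C J : List (List X)) → T (allNonempty C) → count (attach x C) J ≡ matches (unprefix x J) C
  count-attach x []              []                  t = refl
  count-attach x []              ([] ∷ J)            t = refl
  count-attach x []              ((y ∷ []) ∷ J)      t with x ≟ y
  ... | yes refl = ℤP.+-identityʳ _
  ... | no _     = refl
  count-attach x []              ((y ∷ z ∷ w) ∷ J)   t with x ≟ y
  ... | yes refl = refl
  ... | no _     = refl
  count-attach x (p ∷ ps)        []                  t = refl
  count-attach x (p ∷ ps)        ([] ∷ J)            t = refl
  count-attach x ((q ∷ qs) ∷ ps) ((y ∷ []) ∷ J)      t with x ≟ y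
  ... | yes refl = ℤP.+-identityʳ _
  ... | no _     = refl
  count-attach x ((q ∷ qs) ∷ ps) ((y ∷ z ∷ w) ∷ J)   t with x ≟ y
  ... | yes refl = trans (ℤP.+-identityˡ _) (ℤP.+-identityʳ _)
  ... | no _     = refl

  count-compositions : (xs : List X) (J : List (List X)) →
    count (compositions xs) J ≡ 𝟙 (allNonempty J ∧ does (xs ≟L concat J))
  count-compositions []       []             = refl
  count-compositions []       ([] ∷ J)       = refl
  count-compositions []       ((y ∷ w) ∷ J)  with allNonempty J
  ... | true  = refl
  ... | false = refl
  count-compositions (x ∷ xs) J = begin
    count (compositions (x ∷ xs)) J
      ≡⟨ ∑-compositions-∷ x xs (λ C → 𝟙 (does (LP.≡-dec _≟L_ C J))) ⟩
    ∑ (compositions xs) (λ C → count (attach x C) J)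
      ≡⟨ ∑-compositions-sound xs (λ C valid → count-attach x C J (proj₂ valid)) ⟩
    ∑ (compositions xs) (matches (unprefix x J))
      ≡⟨ by-first-word J ⟩
    𝟙 (allNonempty J ∧ does ((x ∷ xs) ≟L concat J)) ∎
    where
    open ≡-Reasoning
    mismatch : ∀ J → ∑ (compositions xs) (λ _ → 0ℤ) ≡ 𝟙 (allNonempty J ∧ false)
    mismatch J = trans (∑-zero (compositions xs)) (cong 𝟙 (sym (∧-zeroʳ (allNonempty J))))
    by-first-word : (J : List (List X)) →
      ∑ (compositions xs) (matches (unprefix x J)) ≡ 𝟙 (allNonempty J ∧ does ((x ∷ xs) ≟L concat J))
    by-first-word []                = ∑-zero (compositions xs)
    by-first-word ([] ∷ J)          = ∑-zero (compositions xs)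
    by-first-word ((y ∷ []) ∷ J)    with x ≟ y
    ... | yes refl = count-compositions xs J
    ... | no _     = mismatch J
    by-first-word ((y ∷ z ∷ w) ∷ J) with x ≟ y
    ... | yes refl = count-compositions xs ((z ∷ w) ∷ J)
    ... | no _     = mismatch J

module _ {X : Set} where

  allNonempty-++ : (xs ys : List (List X)) → T (allNonempty xs) → T (allNonempty ys) → T (allNonempty (xs ++ ys))
  allNonempty-++ []             ys tx ty = ty
  allNonempty-++ ((x ∷ w) ∷ xs) ys tx ty = allNonempty-++ xs ys tx ty

  allNonempty-++⁻ʳ : (xs ys : List (List X)) → T (allNonempty (xs ++ ys)) → T (allNonempty ys)
  allNonempty-++⁻ʳ []             ys t = t
  allNonempty-++⁻ʳ ((x ∷ w) ∷ xs) ys t = allNonempty-++⁻ʳ xs ys t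

  allNonempty-reverse : (xs : List (List X)) → T (allNonempty xs) → T (allNonempty (reverse xs))
  allNonempty-reverse []             t = tt
  allNonempty-reverse ((x ∷ w) ∷ xs) t =
    subst (T ∘ allNonempty) (sym (LP.unfold-reverse (x ∷ w) xs)) (allNonempty-++ (reverse xs) _ (allNonempty-reverse xs t) tt)

  allNonempty-map-concat : (C : List (List (List X))) → T (allNonempty (concat C)) → T (allNonempty C) →
    T (allNonempty (map concat C))
  allNonempty-map-concat []                   t₁ t₂ = tt
  allNonempty-map-concat (((x ∷ w) ∷ B) ∷ C) t₁ t₂ = allNonempty-map-concat C (allNonempty-++⁻ʳ B (concat C) t₁) t₂

coarsenings-letters : {n : ℕ} (xs : List (Fin n)) → coarsenings (letters xs) ≡ compositions xs
coarsenings-letters []       = refl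
coarsenings-letters (x ∷ xs) = begin
  map (map concat) (compositions ([ x ] ∷ letters xs))
    ≡⟨ cong (map (map concat)) (compositions-∷ [ x ] (letters xs)) ⟩
  map (map concat) (concatMap (attach [ x ]) (compositions (letters xs)))
    ≡⟨ LP.map-concatMap (map concat) (attach [ x ]) (compositions (letters xs)) ⟩
  concatMap (map (map concat) ∘ attach [ x ]) (compositions (letters xs))
    ≡⟨ LP.concatMap-cong (λ { [] → refl ; (p ∷ ps) → refl }) (compositions (letters xs)) ⟩
  concatMap (attach x ∘ map concat) (compositions (letters xs))
    ≡⟨ LP.concatMap-map (attach x) (map concat) (compositions (letters xs)) ⟨
  concatMap (attach x) (coarsenings (letters xs))
    ≡⟨ cong (concatMap (attach x)) (coarsenings-letters xs) ⟩
  concatMap (attach x) (compositions xs)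
    ≡⟨ compositions-∷ x xs ⟨
  compositions (x ∷ xs) ∎
  where open ≡-Reasoning

∑-tabulate : {X : Set} (n : ℕ) (f : Fin n → X) (h : X → ℤ) → ∑ (tabulate f) h ≡ ∑ (allFin n) (h ∘ f)
∑-tabulate zero    f h = refl
∑-tabulate (suc n) f h = cong (h (f Fin.zero) +_) (trans (∑-tabulate n (f ∘ Fin.suc) h) (sym (∑-tabulate n Fin.suc (h ∘ f))))

∑-applyUpTo : {X : Set} (f : ℕ → X) (n : ℕ) (h : X → ℤ) → ∑ (applyUpTo f n) h ≡ ∑ (upTo n) (h ∘ f)
∑-applyUpTo f zero    h = refl
∑-applyUpTo f (suc n) h = cong (h (f 0) +_) (trans (∑-applyUpTo (f ∘ suc) n h) (sym (∑-applyUpTo suc n (h ∘ f))))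

count-allFin : (n : ℕ) (c : Fin n) → ∑ (allFin n) (λ a → 𝟙 (does (a Fin.≟ c))) ≡ 1ℤ
count-allFin (suc n) Fin.zero    =
  cong (1ℤ +_) (trans (∑-tabulate n Fin.suc (λ a → 𝟙 (does (a Fin.≟ Fin.zero)))) (∑-zero (allFin n)))
count-allFin (suc n) (Fin.suc c) =
  trans (ℤP.+-identityˡ _) (trans (∑-tabulate n Fin.suc (λ a → 𝟙 (does (a Fin.≟ Fin.suc c)))) (count-allFin n c))

count-upTo : (D m : ℕ) → ∑ (upTo D) (λ L → 𝟙 (m ≡ᵇ L)) ≡ 𝟙 (m <ᵇ D)
count-upTo zero    m       = refl
count-upTo (suc D) zero    = cong (1ℤ +_) (trans (∑-applyUpTo suc D (λ L → 𝟙 (0 ≡ᵇ L))) (∑-zero (upTo D)))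
count-upTo (suc D) (suc m) = trans (ℤP.+-identityˡ _) (trans (∑-applyUpTo suc D (λ L → 𝟙 (suc m ≡ᵇ L))) (count-upTo D m))

module _ {n : ℕ} where

  _≟W_ : DecidableEquality (Word n)
  _≟W_ = LP.≡-dec Fin._≟_

  _≟SS_ : DecidableEquality (Sentence n)
  _≟SS_ = LP.≡-dec _≟W_

  open Counting _≟W_ public using () renaming (count to countW; ∑-𝟙-≟ to ∑-𝟙-≟W)
  open Counting _≟SS_ public using ()
    renaming (count to countS; ∑-𝟙-≟ to ∑-𝟙-≟S; does-≟-sym to does-≟S-sym; count-unique to countS-unique; count≢0⇒∈ to countS≢0⇒∈)
  open CountCompositions (Fin._≟_ {n}) using (count-compositions)

  count-wordsOfLength : (L : ℕ) (u : Word n) → countW (wordsOfLength {n} L) u ≡ 𝟙 (length u ≡ᵇ L)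
  count-wordsOfLength zero    []      = refl
  count-wordsOfLength zero    (c ∷ u) = refl
  count-wordsOfLength (suc L) []      =
    trans (∑-concatMap (λ a → map (a ∷_) (wordsOfLength L)) (allFin n) (λ v → 𝟙 (does (v ≟W []))))
      (∑-vanishes (allFin n) _ (λ a → trans (∑-map (a ∷_) (wordsOfLength L) (λ v → 𝟙 (does (v ≟W [])))) (∑-zero (wordsOfLength L))))
  count-wordsOfLength (suc L) (c ∷ u) = begin
    countW (wordsOfLength (suc L)) (c ∷ u)
      ≡⟨ ∑-concatMap (λ a → map (a ∷_) (wordsOfLength L)) (allFin n) (λ v → 𝟙 (does (v ≟W (c ∷ u)))) ⟩
    ∑ (allFin n) (λ a → ∑ (map (a ∷_) (wordsOfLength L)) (λ v → 𝟙 (does (v ≟W (c ∷ u)))))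
      ≡⟨ ∑-cong (allFin n) (λ a → trans (∑-map (a ∷_) (wordsOfLength L) (λ v → 𝟙 (does (v ≟W (c ∷ u)))))
           (trans (∑-cong (wordsOfLength L) (λ v → 𝟙-∧ (does (a Fin.≟ c)) (does (v ≟W u))))
                  (∑-*ˡ (wordsOfLength L) (𝟙 (does (a Fin.≟ c))) (λ v → 𝟙 (does (v ≟W u)))))) ⟩
    ∑ (allFin n) (λ a → 𝟙 (does (a Fin.≟ c)) * countW (wordsOfLength L) u)
      ≡⟨ ∑-*ʳ (allFin n) (countW (wordsOfLength L) u) (λ a → 𝟙 (does (a Fin.≟ c))) ⟩
    ∑ (allFin n) (λ a → 𝟙 (does (a Fin.≟ c))) * countW (wordsOfLength L) u
      ≡⟨ cong₂ _*_ (count-allFin n c) (count-wordsOfLength L u) ⟩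
    1ℤ * 𝟙 (length u ≡ᵇ L)
      ≡⟨ ℤP.*-identityˡ _ ⟩
    𝟙 (length u ≡ᵇ L) ∎
    where open ≡-Reasoning

  ∑-wordsUpTo-𝟙-≟ : (D : ℕ) (u : Word n) (Ψ : Word n → ℤ) →
    ∑ (upTo (suc D)) (λ L → ∑ (wordsOfLength L) (λ u′ → 𝟙 (does (u′ ≟W u)) * Ψ u′)) ≡ 𝟙 (length u <ᵇ suc D) * Ψ u
  ∑-wordsUpTo-𝟙-≟ D u Ψ = begin
    ∑ (upTo (suc D)) (λ L → ∑ (wordsOfLength L) (λ u′ → 𝟙 (does (u′ ≟W u)) * Ψ u′))
      ≡⟨ ∑-cong (upTo (suc D)) (λ L → trans (∑-𝟙-≟W (wordsOfLength L) u Ψ) (cong (_* Ψ u) (count-wordsOfLength L u))) ⟩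
    ∑ (upTo (suc D)) (λ L → 𝟙 (length u ≡ᵇ L) * Ψ u)
      ≡⟨ ∑-*ʳ (upTo (suc D)) (Ψ u) (λ L → 𝟙 (length u ≡ᵇ L)) ⟩
    ∑ (upTo (suc D)) (λ L → 𝟙 (length u ≡ᵇ L)) * Ψ u
      ≡⟨ cong (_* Ψ u) (count-upTo (suc D) (length u)) ⟩
    𝟙 (length u <ᵇ suc D) * Ψ u ∎
    where open ≡-Reasoning

  length-concat : (K : Sentence n) → length (concat K) ≡ size K
  length-concat []      = refl
  length-concat (w ∷ K) = trans (LP.length-++ w) (cong (length w +ℕ_) (length-concat K))

  count-sentencesUpTo : (N : ℕ) (K : Sentence n) →
    countS (sentencesUpTo N) K ≡ 𝟙 (allNonempty K) * 𝟙 (size K <ᵇ suc N)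
  count-sentencesUpTo N K = begin
    countS (sentencesUpTo N) K
      ≡⟨ ∑-concatMap (λ L → concatMap compositions (wordsOfLength L)) (upTo (suc N)) (λ J → 𝟙 (does (J ≟SS K))) ⟩
    ∑ (upTo (suc N)) (λ L → ∑ (concatMap compositions (wordsOfLength L)) (λ J → 𝟙 (does (J ≟SS K))))
      ≡⟨ ∑-cong (upTo (suc N)) (λ L → trans (∑-concatMap compositions (wordsOfLength L) (λ J → 𝟙 (does (J ≟SS K))))
           (trans (∑-cong (wordsOfLength L) (λ w → trans (count-compositions w K) (𝟙-∧ (allNonempty K) _)))
           (trans (∑-*ˡ (wordsOfLength L) (𝟙 (allNonempty K)) _)
                  (cong (𝟙 (allNonempty K) *_) (count-wordsOfLength L (concat K)))))) ⟩
    ∑ (upTo (suc N)) (λ L → 𝟙 (allNonempty K) * 𝟙 (length (concat K) ≡ᵇ L))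
      ≡⟨ ∑-*ˡ (upTo (suc N)) (𝟙 (allNonempty K)) (λ L → 𝟙 (length (concat K) ≡ᵇ L)) ⟩
    𝟙 (allNonempty K) * ∑ (upTo (suc N)) (λ L → 𝟙 (length (concat K) ≡ᵇ L))
      ≡⟨ cong (𝟙 (allNonempty K) *_) (trans (count-upTo (suc N) (length (concat K))) (cong (λ m → 𝟙 (m <ᵇ suc N)) (length-concat K))) ⟩
    𝟙 (allNonempty K) * 𝟙 (size K <ᵇ suc N) ∎
    where open ≡-Reasoning

module _ {n : ℕ} where

  termCoeff : Sentence n → ℤ × Sentence n → ℤ
  termCoeff K t = onlyIf (proj₂ t ≟S K) (proj₁ t)

  coeff-∑ : (f : NSym n) (K : Sentence n) → coeff f K ≡ ∑ f (termCoeff K)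
  coeff-∑ []      K = refl
  coeff-∑ (t ∷ f) K = cong (termCoeff K t +_) (coeff-∑ f K)

  coeff-concatMap : {X : Set} (h : X → NSym n) (xs : List X) (K : Sentence n) →
    coeff (concatMap h xs) K ≡ ∑ xs (λ x → coeff (h x) K)
  coeff-concatMap h xs K = begin
    coeff (concatMap h xs) K              ≡⟨ coeff-∑ (concatMap h xs) K ⟩
    ∑ (concatMap h xs) (termCoeff K)      ≡⟨ ∑-concatMap h xs (termCoeff K) ⟩
    ∑ xs (λ x → ∑ (h x) (termCoeff K))    ≡⟨ ∑-cong xs (λ x → coeff-∑ (h x) K) ⟨
    ∑ xs (λ x → coeff (h x) K)            ∎
    where open ≡-Reasoning

  coeff-scale : (c : ℤ) (f : NSym n) (K : Sentence n) → coeff (scale c f) K ≡ c * coeff f K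
  coeff-scale c f K = begin
    coeff (scale c f) K                                  ≡⟨ coeff-∑ (scale c f) K ⟩
    ∑ (scale c f) (termCoeff K)                          ≡⟨ ∑-map _ f (termCoeff K) ⟩
    ∑ f (λ t → onlyIf (proj₂ t ≟S K) (c * proj₁ t))      ≡⟨ ∑-cong f (λ t → onlyIf-* (proj₂ t ≟S K) c (proj₁ t)) ⟩
    ∑ f (λ t → c * termCoeff K t)                        ≡⟨ ∑-*ˡ f c (termCoeff K) ⟩
    c * ∑ f (termCoeff K)                                ≡⟨ cong (c *_) (coeff-∑ f K) ⟨
    c * coeff f K                                        ∎
    where open ≡-Reasoning

  afterWord : Word n → Sentence n → (Sentence n → ℤ) → ℤ
  afterWord w []        φ = 0ℤ
  afterWord w (w′ ∷ K′) φ = onlyIf (does (w ≟W w′)) (φ K′)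

  coeff-Hmul : (w : Word n) (f : NSym n) (K : Sentence n) → coeff (Hmul w f) K ≡ afterWord w K (coeff f)
  coeff-Hmul w f []        = trans (coeff-∑ (Hmul w f) []) (trans (∑-map _ f (termCoeff [])) (∑-zero f))
  coeff-Hmul w f (w′ ∷ K′) = begin
    coeff (Hmul w f) (w′ ∷ K′)
      ≡⟨ trans (coeff-∑ (Hmul w f) (w′ ∷ K′)) (∑-map _ f (termCoeff (w′ ∷ K′))) ⟩
    ∑ f (λ t → onlyIf (does (w ≟W w′) ∧ (proj₂ t ≟S K′)) (proj₁ t))
      ≡⟨ ∑-cong f (λ t → onlyIf-∧ (does (w ≟W w′)) (proj₂ t ≟S K′) (proj₁ t)) ⟩
    ∑ f (λ t → onlyIf (does (w ≟W w′)) (termCoeff K′ t))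
      ≡⟨ ∑-onlyIf f (does (w ≟W w′)) (termCoeff K′) ⟩
    onlyIf (does (w ≟W w′)) (∑ f (termCoeff K′))
      ≡⟨ cong (onlyIf (does (w ≟W w′))) (coeff-∑ f K′) ⟨
    onlyIf (does (w ≟W w′)) (coeff f K′) ∎
    where open ≡-Reasoning

  HasMatrix : (NSym n → NSym n) → (Sentence n → Sentence n → ℤ) → Set
  HasMatrix Φ m = ∀ g K → coeff (Φ g) K ≡ ∑ g (λ t → proj₁ t * m (proj₂ t) K)

  concatMap-matrix : {X : Set} (xs : List X) {Φ : X → NSym n → NSym n} {m : X → Sentence n → Sentence n → ℤ} →
    (∀ x → HasMatrix (Φ x) (m x)) → HasMatrix (λ g → concatMap (λ x → Φ x g) xs) (λ I K → ∑ xs (λ x → m x I K))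
  concatMap-matrix xs {Φ} {m} Φ-m g K = begin
    coeff (concatMap (λ x → Φ x g) xs) K                          ≡⟨ coeff-concatMap (λ x → Φ x g) xs K ⟩
    ∑ xs (λ x → coeff (Φ x g) K)                                  ≡⟨ ∑-cong xs (λ x → Φ-m x g K) ⟩
    ∑ xs (λ x → ∑ g (λ t → proj₁ t * m x (proj₂ t) K))            ≡⟨ ∑-swap-*ˡ xs g proj₁ (λ x t → m x (proj₂ t) K) ⟩
    ∑ g (λ t → proj₁ t * ∑ xs (λ x → m x (proj₂ t) K))            ∎
    where open ≡-Reasoning

  scale-matrix : (c : ℤ) {Φ : NSym n → NSym n} {m : Sentence n → Sentence n → ℤ} →
    HasMatrix Φ m → HasMatrix (scale c ∘ Φ) (λ I K → c * m I K)
  scale-matrix c {Φ} {m} Φ-m g K = begin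
    coeff (scale c (Φ g)) K                        ≡⟨ coeff-scale c (Φ g) K ⟩
    c * coeff (Φ g) K                              ≡⟨ cong (c *_) (Φ-m g K) ⟩
    c * ∑ g (λ t → proj₁ t * m (proj₂ t) K)        ≡⟨ ∑-*ˡ g c _ ⟨
    ∑ g (λ t → c * (proj₁ t * m (proj₂ t) K))      ≡⟨ ∑-cong g (λ t → x∙yz≈y∙xz c (proj₁ t) (m (proj₂ t) K)) ⟩
    ∑ g (λ t → proj₁ t * (c * m (proj₂ t) K))      ∎
    where
    open ≡-Reasoning

  Hmul-matrix : (w : Word n) {Φ : NSym n → NSym n} {m : Sentence n → Sentence n → ℤ} →
    HasMatrix Φ m → HasMatrix (Hmul w ∘ Φ) (λ I K → afterWord w K (m I))
  Hmul-matrix w {Φ} {m} Φ-m g []        = trans (coeff-Hmul w (Φ g) []) (sym (∑-vanishes g _ (λ t → ℤP.*-zeroʳ (proj₁ t))))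
  Hmul-matrix w {Φ} {m} Φ-m g (w′ ∷ K′) = begin
    coeff (Hmul w (Φ g)) (w′ ∷ K′)                                  ≡⟨ coeff-Hmul w (Φ g) (w′ ∷ K′) ⟩
    onlyIf (does (w ≟W w′)) (coeff (Φ g) K′)                        ≡⟨ cong (onlyIf (does (w ≟W w′))) (Φ-m g K′) ⟩
    onlyIf (does (w ≟W w′)) (∑ g (λ t → proj₁ t * m (proj₂ t) K′))  ≡⟨ ∑-onlyIf g (does (w ≟W w′)) _ ⟨
    ∑ g (λ t → onlyIf (does (w ≟W w′)) (proj₁ t * m (proj₂ t) K′))  ≡⟨ ∑-cong g (λ t → onlyIf-* (does (w ≟W w′)) (proj₁ t) _) ⟩
    ∑ g (λ t → proj₁ t * onlyIf (does (w ≟W w′)) (m (proj₂ t) K′))  ∎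
    where open ≡-Reasoning

  MperpEntry : Sentence n → Sentence n → Sentence n → ℤ
  MperpEntry S I K = ∑ (sentencesUpTo (size I)) (λ J → onlyIf (J ≟S K) (⁺ (prodCoeff I J S)))

  Mperp-matrix : (S : Sentence n) → HasMatrix (Mperp S) (MperpEntry S)
  Mperp-matrix S g K = trans (coeff-concatMap term g K) (∑-cong g λ t → begin
    coeff (term t) K
      ≡⟨ trans (coeff-∑ (term t) K) (∑-map (λ J → (proj₁ t * ⁺ (prodCoeff (proj₂ t) J S) , J)) (sentencesUpTo (size (proj₂ t))) (termCoeff K)) ⟩
    ∑ (sentencesUpTo (size (proj₂ t))) (λ J → onlyIf (J ≟S K) (proj₁ t * ⁺ (prodCoeff (proj₂ t) J S)))
      ≡⟨ ∑-cong (sentencesUpTo (size (proj₂ t))) (λ J → onlyIf-* (J ≟S K) (proj₁ t) _) ⟩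
    ∑ (sentencesUpTo (size (proj₂ t))) (λ J → proj₁ t * onlyIf (J ≟S K) (⁺ (prodCoeff (proj₂ t) J S)))
      ≡⟨ ∑-*ˡ (sentencesUpTo (size (proj₂ t))) (proj₁ t) _ ⟩
    proj₁ t * MperpEntry S (proj₂ t) K ∎)
    where
    open ≡-Reasoning
    term : ℤ × Sentence n → NSym n
    term t = map (λ J → (proj₁ t * ⁺ (prodCoeff (proj₂ t) J S) , J)) (sentencesUpTo (size (proj₂ t)))

  -- 𝔹 with the degree cut-off deg f replaced by a fixed D, so that 𝔹 v f is definitionally 𝔹≤ (deg f) v f
  𝔹≤ : ℕ → Word n → NSym n → NSym n
  𝔹≤ D v f =
    concatMap (λ L → concatMap (λ u → concatMap (λ Q →
      scale (sgn (length Q)) (Hmul (v ++ u) (concatMap (λ S → Mperp S f) (coarsenings Q))))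
      (revSentencesOf u)) (wordsOfLength L)) (upTo (suc D))

  𝔹Entry : ℕ → Word n → Sentence n → Sentence n → ℤ
  𝔹Entry D v I K =
    ∑ (upTo (suc D)) (λ L → ∑ (wordsOfLength L) (λ u → ∑ (revSentencesOf u) (λ Q →
      sgn (length Q) * afterWord (v ++ u) K (λ K′ → ∑ (coarsenings Q) (λ S → MperpEntry S I K′)))))

  𝔹≤-matrix : (D : ℕ) (v : Word n) → HasMatrix (𝔹≤ D v) (𝔹Entry D v)
  𝔹≤-matrix D v =
    concatMap-matrix (upTo (suc D)) {Φ = 𝔹≤L} λ L →
    concatMap-matrix (wordsOfLength L) {Φ = 𝔹≤u} λ u →
    concatMap-matrix (revSentencesOf u) {Φ = 𝔹≤Q u} λ Q →
    scale-matrix (sgn (length Q)) {Φ = Hmul (v ++ u) ∘ coarse Q} (Hmul-matrix (v ++ u) {Φ = coarse Q}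
      (concatMap-matrix (coarsenings Q) {Φ = Mperp} Mperp-matrix))
    where
    coarse : Sentence n → NSym n → NSym n
    coarse Q g = concatMap (λ S → Mperp S g) (coarsenings Q)
    𝔹≤Q : Word n → Sentence n → NSym n → NSym n
    𝔹≤Q u Q g = scale (sgn (length Q)) (Hmul (v ++ u) (coarse Q g))
    𝔹≤u : Word n → NSym n → NSym n
    𝔹≤u u g = concatMap (λ Q → 𝔹≤Q u Q g) (revSentencesOf u)
    𝔹≤L : ℕ → NSym n → NSym n
    𝔹≤L L g = concatMap (λ u → 𝔹≤u u g) (wordsOfLength L)

module _ {n : ℕ} where

  Splitting : Set
  Splitting = List (Word n × Word n)

  prefixes suffixes : Splitting → Sentence n
  prefixes σ = nonemptyParts (map proj₁ σ)
  suffixes σ = nonemptyParts (map proj₂ σ)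

  Weight : Set
  Weight = Sentence n → Sentence n → ℤ

  splitWeight : Weight → Weight → Weight → Splitting → ℤ
  splitWeight h₁ h₂ h₃ []                = h₃ [] []
  splitWeight h₁ h₂ h₃ (([] , s) ∷ ρ)    = h₂ (prefixes (([] , s) ∷ ρ)) (suffixes (([] , s) ∷ ρ))
  splitWeight h₁ h₂ h₃ ((x ∷ p , s) ∷ ρ) = h₁ (prefixes ((x ∷ p , s) ∷ ρ)) (suffixes ((x ∷ p , s) ∷ ρ))

  splitWeight-uniform : (h : Weight) (σ : Splitting) → splitWeight h h h σ ≡ h (prefixes σ) (suffixes σ)
  splitWeight-uniform h []                = refl
  splitWeight-uniform h (([] , s) ∷ ρ)    = refl
  splitWeight-uniform h ((x ∷ p , s) ∷ ρ) = refl

  splitSum : Weight → Weight → Weight → Sentence n → ℤ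
  splitSum h₁ h₂ h₃ I = ∑ (allSplits I) (splitWeight h₁ h₂ h₃)

  signedSplitSum : Word n → Weight → Weight → Weight → ℤ
  signedSplitSum bs h₁ h₂ h₃ = ∑ (compositions bs) (λ I → sgn (length I) * splitSum h₁ h₂ h₃ I)

  extendFirst : Fin n → Sentence n → Sentence n
  extendFirst b []       = []
  extendFirst b (w ∷ ws) = (b ∷ w) ∷ ws

  ∑-allSplits-∷ : (x : Fin n) (w : Word n) (ws : Sentence n) (φ : Splitting → ℤ) →
    ∑ (allSplits ((x ∷ w) ∷ ws)) φ ≡
      ∑ (allSplits ws) (λ ρ → φ (([] , x ∷ w) ∷ ρ)) +
      ∑ (splits w) (λ q → ∑ (allSplits ws) (λ ρ → φ ((x ∷ proj₁ q , proj₂ q) ∷ ρ)))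
  ∑-allSplits-∷ x w ws φ = begin
    ∑ (allSplits ((x ∷ w) ∷ ws)) φ
      ≡⟨ ∑-concatMap (λ p → map (p ∷_) (allSplits ws)) (splits (x ∷ w)) φ ⟩
    ∑ (splits (x ∷ w)) (λ p → ∑ (map (p ∷_) (allSplits ws)) φ)
      ≡⟨ ∑-cong (splits (x ∷ w)) (λ p → ∑-map (p ∷_) (allSplits ws) φ) ⟩
    ∑ (allSplits ws) (λ ρ → φ (([] , x ∷ w) ∷ ρ)) +
      ∑ (map (λ p → (x ∷ proj₁ p , proj₂ p)) (splits w)) (λ p → ∑ (allSplits ws) (λ ρ → φ (p ∷ ρ)))
      ≡⟨ cong (∑ (allSplits ws) (λ ρ → φ (([] , x ∷ w) ∷ ρ)) +_) (∑-map (λ p → (x ∷ proj₁ p , proj₂ p)) (splits w) (λ p → ∑ (allSplits ws) (λ ρ → φ (p ∷ ρ)))) ⟩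
    ∑ (allSplits ws) (λ ρ → φ (([] , x ∷ w) ∷ ρ)) +
      ∑ (splits w) (λ q → ∑ (allSplits ws) (λ ρ → φ ((x ∷ proj₁ q , proj₂ q) ∷ ρ))) ∎
    where open ≡-Reasoning

  ∑-allSplits-[]∷ : (b : Fin n) (I : Sentence n) (φ : Splitting → ℤ) →
    ∑ (allSplits ([ b ] ∷ I)) φ ≡ ∑ (allSplits I) (λ σ → φ (([] , [ b ]) ∷ σ) + φ (([ b ] , []) ∷ σ))
  ∑-allSplits-[]∷ b I φ = begin
    ∑ (allSplits ([ b ] ∷ I)) φ
      ≡⟨ ∑-concatMap (λ p → map (p ∷_) (allSplits I)) (splits [ b ]) φ ⟩
    ∑ (map (([] , [ b ]) ∷_) (allSplits I)) φ + (∑ (map (([ b ] , []) ∷_) (allSplits I)) φ + 0ℤ)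
      ≡⟨ cong₂ _+_ (∑-map (([] , [ b ]) ∷_) (allSplits I) φ) (trans (ℤP.+-identityʳ _) (∑-map (([ b ] , []) ∷_) (allSplits I) φ)) ⟩
    ∑ (allSplits I) (λ σ → φ (([] , [ b ]) ∷ σ)) + ∑ (allSplits I) (λ σ → φ (([ b ] , []) ∷ σ))
      ≡⟨ ∑-+ (allSplits I) _ _ ⟨
    ∑ (allSplits I) (λ σ → φ (([] , [ b ]) ∷ σ) + φ (([ b ] , []) ∷ σ)) ∎
    where open ≡-Reasoning

  separatedSum : Word n → Weight → Weight → Weight → ℤ
  separatedSum []       h₁ h₂ h₃ = h₃ [] []
  separatedSum (b ∷ bs) h₁ h₂ h₃ =
    ∑ (compositions (b ∷ bs)) (λ K → sgn (length K) * h₁ K []) +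
    ∑ (splits bs) (λ xy → ∑ (compositions (b ∷ proj₁ xy)) (λ S → sgn (length S) *
       ∑ (compositions (proj₂ xy)) (λ K → sgn (length K) * h₂ K S)))

  peel : Fin n → (Sentence n → ℤ) → Sentence n → ℤ
  peel b φ []       = - φ ([ b ] ∷ [])
  peel b φ (c ∷ cs) = - φ ([ b ] ∷ c ∷ cs) + φ (extendFirst b (c ∷ cs))

  ∑-sgn-compositions-∷ : (b : Fin n) (z : Word n) (φ : Sentence n → ℤ) →
    ∑ (compositions (b ∷ z)) (λ C → sgn (length C) * φ C) ≡ ∑ (compositions z) (λ C → sgn (length C) * peel b φ C)
  ∑-sgn-compositions-∷ b z φ = trans (∑-compositions-∷ b z (λ C → sgn (length C) * φ C)) (∑-cong (compositions z) attach-peel)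
    where
    attach-peel : ∀ C → ∑ (attach b C) (λ C′ → sgn (length C′) * φ C′) ≡ sgn (length C) * peel b φ C
    attach-peel []       = rearrange (φ ([ b ] ∷ []))
      where
      rearrange : ∀ p → -1ℤ * p + 0ℤ ≡ 1ℤ * - p
      rearrange = solve-∀
    attach-peel (c ∷ cs) = rearrange (sgn (suc (length cs))) (φ ([ b ] ∷ c ∷ cs)) (φ ((b ∷ c) ∷ cs))
      where
      rearrange : ∀ s p q → -1ℤ * s * p + (s * q + 0ℤ) ≡ s * (- p + q)
      rearrange = solve-∀

  -- The first letter b either forms a new block [b], split as ([] , [b]) or ([b] , []), or is prepended to the
  -- first block; in the latter case it extends the first prefix, or, when that prefix is empty, the first suffix
  -- or a new one-letter prefix.  The weights h′ record the resulting contribution in terms of the remaining splitting.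
  module Peel (b : Fin n) (h₁ h₂ h₃ : Weight) where

    h₁′ h₂′ h₃′ : Weight
    h₁′ P S = - (h₂ P ([ b ] ∷ S) + h₁ ([ b ] ∷ P) S) + h₁ (extendFirst b P) S
    h₂′ P S = - h₂ P ([ b ] ∷ S) + h₂ P (extendFirst b S)
    h₃′ P S = - h₂ P ([ b ] ∷ S) + - h₁ ([ b ] ∷ P) S

    newBlock : Splitting → ℤ
    newBlock σ = h₂ (prefixes σ) ([ b ] ∷ suffixes σ) + h₁ ([ b ] ∷ prefixes σ) (suffixes σ)

    ∑-attach-splitSum : (I : Sentence n) → T (allNonempty I) →
      ∑ (attach b I) (λ C → sgn (length C) * splitSum h₁ h₂ h₃ C) ≡ sgn (length I) * splitSum h₁′ h₂′ h₃′ I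
    ∑-attach-splitSum [] t = rearrange (h₂ [] ([ b ] ∷ [])) (h₁ ([ b ] ∷ []) [])
      where
      rearrange : ∀ p q → -1ℤ * (p + (q + 0ℤ)) + 0ℤ ≡ 1ℤ * ((- p + - q) + 0ℤ)
      rearrange = solve-∀
    ∑-attach-splitSum ((x ∷ w) ∷ ws) t = begin
      sgn (suc (suc (length ws))) * splitSum h₁ h₂ h₃ ([ b ] ∷ (x ∷ w) ∷ ws) + (s * splitSum h₁ h₂ h₃ ((b ∷ x ∷ w) ∷ ws) + 0ℤ)
        ≡⟨ cong₂ (λ p q → sgn (suc (suc (length ws))) * p + (s * q + 0ℤ))
             (trans (∑-allSplits-[]∷ b ((x ∷ w) ∷ ws) (splitWeight h₁ h₂ h₃)) (∑-allSplits-∷ x w ws newBlock))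
             (trans (∑-allSplits-∷ b (x ∷ w) ws (splitWeight h₁ h₂ h₃))
                    (cong (λ z → b₁ + (b₂ + z)) (∑-map (λ p → (x ∷ proj₁ p , proj₂ p)) (splits w)
                      (λ q → ∑ (allSplits ws) (λ ρ → splitWeight h₁ h₂ h₃ ((b ∷ proj₁ q , proj₂ q) ∷ ρ)))))) ⟩
      -1ℤ * s * (a₁ + a₂) + (s * (b₁ + (b₂ + b₃)) + 0ℤ)
        ≡⟨ cong (λ p → -1ℤ * s * (p + a₂) + (s * (b₁ + (b₂ + b₃)) + 0ℤ)) (∑-+ (allSplits ws) _ _) ⟩
      -1ℤ * s * ((d₁ + b₂) + a₂) + (s * (b₁ + (b₂ + b₃)) + 0ℤ)
        ≡⟨ rearrange s d₁ b₂ a₂ b₁ b₃ ⟩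
      s * ((- d₁ + b₁) + (- a₂ + b₃))
        ≡⟨ cong (s *_) (cong₂ _+_
             (trans (cong (_+ b₁) (sym (∑-neg (allSplits ws) _))) (sym (∑-+ (allSplits ws) _ _)))
             (trans (cong (_+ b₃) (sym (∑-neg (splits w) _))) (trans (sym (∑-+ (splits w) _ _))
               (∑-cong (splits w) λ q →
                 trans (cong (_+ ∑ (allSplits ws) (λ ρ → h₁ ((b ∷ x ∷ proj₁ q) ∷ prefixes ρ) (suffixes ((proj₁ q , proj₂ q) ∷ ρ))))
                             (sym (∑-neg (allSplits ws) _)))
                       (sym (∑-+ (allSplits ws) _ _)))))) ⟩
      s * (∑ (allSplits ws) (λ ρ → splitWeight h₁′ h₂′ h₃′ (([] , x ∷ w) ∷ ρ)) +
           ∑ (splits w) (λ q → ∑ (allSplits ws) (λ ρ → splitWeight h₁′ h₂′ h₃′ ((x ∷ proj₁ q , proj₂ q) ∷ ρ))))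
        ≡⟨ cong (s *_) (∑-allSplits-∷ x w ws (splitWeight h₁′ h₂′ h₃′)) ⟨
      s * splitSum h₁′ h₂′ h₃′ ((x ∷ w) ∷ ws) ∎
      where
      open ≡-Reasoning
      s  = sgn (suc (length ws))
      a₁ = ∑ (allSplits ws) (λ ρ → newBlock (([] , x ∷ w) ∷ ρ))
      a₂ = ∑ (splits w) (λ q → ∑ (allSplits ws) (λ ρ → newBlock ((x ∷ proj₁ q , proj₂ q) ∷ ρ)))
      d₁ = ∑ (allSplits ws) (λ ρ → h₂ (prefixes ρ) ([ b ] ∷ (x ∷ w) ∷ suffixes ρ))
      b₁ = ∑ (allSplits ws) (λ ρ → h₂ (prefixes ρ) ((b ∷ x ∷ w) ∷ suffixes ρ))
      b₂ = ∑ (allSplits ws) (λ ρ → h₁ ([ b ] ∷ prefixes ρ) ((x ∷ w) ∷ suffixes ρ))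
      b₃ = ∑ (splits w) (λ q → ∑ (allSplits ws) (λ ρ → h₁ ((b ∷ x ∷ proj₁ q) ∷ prefixes ρ) (suffixes ((proj₁ q , proj₂ q) ∷ ρ))))
      rearrange : ∀ s d b₂ a₂ b₁ b₃ → -1ℤ * s * ((d + b₂) + a₂) + (s * (b₁ + (b₂ + b₃)) + 0ℤ) ≡ s * ((- d + b₁) + (- a₂ + b₃))
      rearrange = solve-∀

    signedSplitSum-∷ : (bs : Word n) → signedSplitSum (b ∷ bs) h₁ h₂ h₃ ≡ signedSplitSum bs h₁′ h₂′ h₃′
    signedSplitSum-∷ bs = trans (∑-compositions-∷ b bs (λ C → sgn (length C) * splitSum h₁ h₂ h₃ C))
      (∑-compositions-sound bs (λ I valid → ∑-attach-splitSum I (proj₂ valid)))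

    separatedSum-∷ : (bs : Word n) → separatedSum (b ∷ bs) h₁ h₂ h₃ ≡ separatedSum bs h₁′ h₂′ h₃′
    separatedSum-∷ []       = rearrange (h₂ [] ([ b ] ∷ [])) (h₁ ([ b ] ∷ []) [])
      where
      rearrange : ∀ p q → (-1ℤ * q + 0ℤ) + ((-1ℤ * (1ℤ * p + 0ℤ) + 0ℤ) + 0ℤ) ≡ - p + - q
      rearrange = solve-∀
    separatedSum-∷ (c ∷ cs) = begin
      T₁ + (-1ℤ * G + 0ℤ + T₂)
        ≡⟨ cong₂ (λ p q → p + (-1ℤ * G + 0ℤ + q)) (∑-sgn-compositions-∷ b (c ∷ cs) (λ C → h₁ C []))
             (trans (∑-map (λ p → (c ∷ proj₁ p , proj₂ p)) (splits cs) _)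
                    (∑-cong (splits cs) λ xy → ∑-sgn-compositions-∷ b (c ∷ proj₁ xy) (φ (proj₂ xy)))) ⟩
      P₁ + (-1ℤ * G + 0ℤ + P₂)
        ≡⟨ rearrange P₁ G P₂ ⟩
      (- G + P₁) + P₂
        ≡⟨ cong₂ _+_
             (trans (cong (_+ P₁) (sym (∑-neg (compositions (c ∷ cs)) _)))
               (trans (sym (∑-+ (compositions (c ∷ cs)) _ _)) (∑-cong-All (All.map (λ {C} → h₁-terms C) (compositions-∷-nonempty c cs)))))
             (∑-cong (splits cs) (λ xy → ∑-cong-All (All.map (λ {C} → h₂-terms (proj₂ xy) C) (compositions-∷-nonempty c (proj₁ xy))))) ⟩
      separatedSum (c ∷ cs) h₁′ h₂′ h₃′ ∎
      where
      open ≡-Reasoning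
      φ : Word n → Sentence n → ℤ
      φ y S = ∑ (compositions y) (λ K → sgn (length K) * h₂ K S)
      T₁ = ∑ (compositions (b ∷ c ∷ cs)) (λ K → sgn (length K) * h₁ K [])
      G  = ∑ (compositions (c ∷ cs)) (λ K → sgn (length K) * h₂ K ([ b ] ∷ []))
      T₂ = ∑ (map (λ p → (c ∷ proj₁ p , proj₂ p)) (splits cs)) (λ xy → ∑ (compositions (b ∷ proj₁ xy)) (λ S → sgn (length S) * φ (proj₂ xy) S))
      P₁ = ∑ (compositions (c ∷ cs)) (λ C → sgn (length C) * peel b (λ C → h₁ C []) C)
      P₂ = ∑ (splits cs) (λ xy → ∑ (compositions (c ∷ proj₁ xy)) (λ C → sgn (length C) * peel b (φ (proj₂ xy)) C))
      rearrange : ∀ t g r → t + (-1ℤ * g + 0ℤ + r) ≡ (- g + t) + r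
      rearrange = solve-∀
      h₁-terms : ∀ C → C ≢ [] → - (sgn (length C) * h₂ C ([ b ] ∷ [])) + sgn (length C) * peel b (λ C → h₁ C []) C ≡ sgn (length C) * h₁′ C []
      h₁-terms []       ne = ⊥-elim (ne refl)
      h₁-terms (c ∷ cs) _  = distrib (sgn (length (c ∷ cs))) _ _ _
        where
        distrib : ∀ s p q r → - (s * p) + s * (- q + r) ≡ s * (- (p + q) + r)
        distrib = solve-∀
      h₂-terms : ∀ y C → C ≢ [] → sgn (length C) * peel b (φ y) C ≡ sgn (length C) * ∑ (compositions y) (λ K → sgn (length K) * h₂′ K C)
      h₂-terms y []       ne = ⊥-elim (ne refl)
      h₂-terms y (c ∷ cs) _  = cong (sgn (length (c ∷ cs)) *_) (sym (begin
        ∑ (compositions y) (λ K → sgn (length K) * (- h₂ K ([ b ] ∷ c ∷ cs) + h₂ K (extendFirst b (c ∷ cs))))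
          ≡⟨ ∑-cong (compositions y) (λ K → distrib (sgn (length K)) _ _) ⟩
        ∑ (compositions y) (λ K → - (sgn (length K) * h₂ K ([ b ] ∷ c ∷ cs)) + sgn (length K) * h₂ K (extendFirst b (c ∷ cs)))
          ≡⟨ ∑-+ (compositions y) _ _ ⟩
        ∑ (compositions y) (λ K → - (sgn (length K) * h₂ K ([ b ] ∷ c ∷ cs))) + φ y (extendFirst b (c ∷ cs))
          ≡⟨ cong (_+ φ y (extendFirst b (c ∷ cs))) (∑-neg (compositions y) _) ⟩
        - φ y ([ b ] ∷ c ∷ cs) + φ y (extendFirst b (c ∷ cs)) ∎))
        where
        distrib : ∀ s p q → s * (- p + q) ≡ - (s * p) + s * q
        distrib = solve-∀

  signedSplitSum≡separatedSum : (bs : Word n) (h₁ h₂ h₃ : Weight) → signedSplitSum bs h₁ h₂ h₃ ≡ separatedSum bs h₁ h₂ h₃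
  signedSplitSum≡separatedSum []       h₁ h₂ h₃ = rearrange (h₃ [] [])
    where
    rearrange : ∀ p → 1ℤ * (p + 0ℤ) + 0ℤ ≡ p
    rearrange = solve-∀
  signedSplitSum≡separatedSum (b ∷ bs) h₁ h₂ h₃ = begin
    signedSplitSum (b ∷ bs) h₁ h₂ h₃  ≡⟨ Peel.signedSplitSum-∷ b h₁ h₂ h₃ bs ⟩
    signedSplitSum bs h₁′ h₂′ h₃′     ≡⟨ signedSplitSum≡separatedSum bs h₁′ h₂′ h₃′ ⟩
    separatedSum bs h₁′ h₂′ h₃′       ≡⟨ Peel.separatedSum-∷ b h₁ h₂ h₃ bs ⟨
    separatedSum (b ∷ bs) h₁ h₂ h₃    ∎
    where
    open ≡-Reasoning
    open Peel b h₁ h₂ h₃ using (h₁′; h₂′; h₃′)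

  splitsSum : Weight → Word n → ℤ
  splitsSum h bs = ∑ (splits bs) (λ uv → ∑ (compositions (proj₁ uv)) (λ S → sgn (length S) *
    ∑ (compositions (proj₂ uv)) (λ K → sgn (length K) * h K S)))

  separatedSum-uniform : (bs : Word n) (h : Weight) → separatedSum bs h h h ≡ splitsSum h bs
  separatedSum-uniform []       h = sym (rearrange (h [] []))
    where
    rearrange : ∀ p → 1ℤ * (1ℤ * p + 0ℤ) + 0ℤ + 0ℤ ≡ p
    rearrange = solve-∀
  separatedSum-uniform (b ∷ bs) h = sym (cong₂ _+_ (trans (ℤP.+-identityʳ _) (ℤP.*-identityˡ noSuffixTerm))
    (∑-map (λ p → (b ∷ proj₁ p , proj₂ p)) (splits bs) term))
    where
    noSuffixTerm : ℤ
    noSuffixTerm = ∑ (compositions (b ∷ bs)) (λ K → sgn (length K) * h K [])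
    term : Word n × Word n → ℤ
    term uv = ∑ (compositions (proj₁ uv)) (λ S → sgn (length S) * ∑ (compositions (proj₂ uv)) (λ K → sgn (length K) * h K S))

  open CountCompositions (Fin._≟_ {n}) using (count-compositions)

  indicator : Sentence n → Sentence n → Weight
  indicator K₀ S₀ K S = 𝟙 (does (K ≟SS K₀)) * 𝟙 (does (S ≟SS S₀))

  ∑-sgn-compositions-𝟙-≟ : (z : Word n) (K₀ : Sentence n) → T (allNonempty K₀) → (g : ℤ) →
    ∑ (compositions z) (λ C → sgn (length C) * (𝟙 (does (C ≟SS K₀)) * g)) ≡ 𝟙 (does (z ≟W concat K₀)) * (sgn (length K₀) * g)
  ∑-sgn-compositions-𝟙-≟ z K₀ t g = begin
    ∑ (compositions z) (λ C → sgn (length C) * (𝟙 (does (C ≟SS K₀)) * g))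
      ≡⟨ ∑-cong (compositions z) (λ C → x∙yz≈y∙xz (sgn (length C)) (𝟙 (does (C ≟SS K₀))) g) ⟩
    ∑ (compositions z) (λ C → 𝟙 (does (C ≟SS K₀)) * (sgn (length C) * g))
      ≡⟨ ∑-𝟙-≟S (compositions z) K₀ (λ C → sgn (length C) * g) ⟩
    countS (compositions z) K₀ * (sgn (length K₀) * g)
      ≡⟨ cong (_* (sgn (length K₀) * g)) (count-compositions z K₀) ⟩
    𝟙 (allNonempty K₀ ∧ does (z ≟W concat K₀)) * (sgn (length K₀) * g)
      ≡⟨ cong (λ a → 𝟙 (a ∧ does (z ≟W concat K₀)) * (sgn (length K₀) * g)) (T⇒≡true t) ⟩
    𝟙 (does (z ≟W concat K₀)) * (sgn (length K₀) * g) ∎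
    where
    open ≡-Reasoning
    T⇒≡true : ∀ {b} → T b → b ≡ true
    T⇒≡true {true} _ = refl

  ∑-splits-𝟙-≟ : (z s k : Word n) →
    ∑ (splits z) (λ xy → 𝟙 (does (proj₁ xy ≟W s)) * 𝟙 (does (proj₂ xy ≟W k))) ≡ 𝟙 (does (z ≟W (s ++ k)))
  ∑-splits-𝟙-≟ []      []      k = trans (ℤP.+-identityʳ _) (ℤP.*-identityˡ _)
  ∑-splits-𝟙-≟ []      (d ∷ s) k = refl
  ∑-splits-𝟙-≟ (c ∷ z) []      k =
    trans (cong (1ℤ * 𝟙 (does ((c ∷ z) ≟W k)) +_) (trans (∑-map _ (splits z) _) (∑-zero (splits z))))
          (trans (ℤP.+-identityʳ _) (ℤP.*-identityˡ _))
  ∑-splits-𝟙-≟ (c ∷ z) (d ∷ s) k = begin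
    0ℤ * 𝟙 (does ((c ∷ z) ≟W k)) + ∑ (map (λ p → (c ∷ proj₁ p , proj₂ p)) (splits z)) term
      ≡⟨ trans (ℤP.+-identityˡ _) (∑-map (λ p → (c ∷ proj₁ p , proj₂ p)) (splits z) term) ⟩
    ∑ (splits z) (λ xy → 𝟙 (does (c Fin.≟ d) ∧ does (proj₁ xy ≟W s)) * 𝟙 (does (proj₂ xy ≟W k)))
      ≡⟨ ∑-cong (splits z) (λ xy → trans (cong (_* 𝟙 (does (proj₂ xy ≟W k))) (𝟙-∧ (does (c Fin.≟ d)) (does (proj₁ xy ≟W s))))
                                         (ℤP.*-assoc (𝟙 (does (c Fin.≟ d))) _ _)) ⟩
    ∑ (splits z) (λ xy → 𝟙 (does (c Fin.≟ d)) * (𝟙 (does (proj₁ xy ≟W s)) * 𝟙 (does (proj₂ xy ≟W k))))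
      ≡⟨ ∑-*ˡ (splits z) (𝟙 (does (c Fin.≟ d))) _ ⟩
    𝟙 (does (c Fin.≟ d)) * ∑ (splits z) (λ xy → 𝟙 (does (proj₁ xy ≟W s)) * 𝟙 (does (proj₂ xy ≟W k)))
      ≡⟨ cong (𝟙 (does (c Fin.≟ d)) *_) (∑-splits-𝟙-≟ z s k) ⟩
    𝟙 (does (c Fin.≟ d)) * 𝟙 (does (z ≟W (s ++ k)))
      ≡⟨ 𝟙-∧ (does (c Fin.≟ d)) (does (z ≟W (s ++ k))) ⟨
    𝟙 (does ((c ∷ z) ≟W (d ∷ s ++ k))) ∎
    where
    open ≡-Reasoning
    term : Word n × Word n → ℤ
    term xy = 𝟙 (does (proj₁ xy ≟W (d ∷ s))) * 𝟙 (does (proj₂ xy ≟W k))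

  splitsSum-indicator : (bs : Word n) (K₀ S₀ : Sentence n) → T (allNonempty K₀) → T (allNonempty S₀) →
    splitsSum (indicator K₀ S₀) bs ≡ (sgn (length S₀) * sgn (length K₀)) * 𝟙 (does (bs ≟W (concat S₀ ++ concat K₀)))
  splitsSum-indicator bs K₀ S₀ tK tS = begin
    splitsSum (indicator K₀ S₀) bs
      ≡⟨ ∑-cong (splits bs) (λ uv → ∑-cong (compositions (proj₁ uv)) λ S → cong (sgn (length S) *_)
           (∑-sgn-compositions-𝟙-≟ (proj₂ uv) K₀ tK (𝟙 (does (S ≟SS S₀))))) ⟩
    ∑ (splits bs) (λ uv → ∑ (compositions (proj₁ uv)) (λ S → sgn (length S) *
      (𝟙 (does (proj₂ uv ≟W concat K₀)) * (sgn (length K₀) * 𝟙 (does (S ≟SS S₀))))))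
      ≡⟨ ∑-cong (splits bs) (λ uv → trans
           (∑-cong (compositions (proj₁ uv)) (λ S → cong (sgn (length S) *_) (exchange (𝟙 (does (proj₂ uv ≟W concat K₀))) (sgn (length K₀)) _)))
           (∑-sgn-compositions-𝟙-≟ (proj₁ uv) S₀ tS _)) ⟩
    ∑ (splits bs) (λ uv → 𝟙 (does (proj₁ uv ≟W concat S₀)) * (sgn (length S₀) * (𝟙 (does (proj₂ uv ≟W concat K₀)) * sgn (length K₀))))
      ≡⟨ ∑-cong (splits bs) (λ uv → regroup (𝟙 (does (proj₁ uv ≟W concat S₀))) (sgn (length S₀)) (𝟙 (does (proj₂ uv ≟W concat K₀))) (sgn (length K₀))) ⟩
    ∑ (splits bs) (λ uv → (sgn (length S₀) * sgn (length K₀)) * (𝟙 (does (proj₁ uv ≟W concat S₀)) * 𝟙 (does (proj₂ uv ≟W concat K₀))))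
      ≡⟨ ∑-*ˡ (splits bs) (sgn (length S₀) * sgn (length K₀)) (λ uv → 𝟙 (does (proj₁ uv ≟W concat S₀)) * 𝟙 (does (proj₂ uv ≟W concat K₀))) ⟩
    (sgn (length S₀) * sgn (length K₀)) * ∑ (splits bs) (λ uv → 𝟙 (does (proj₁ uv ≟W concat S₀)) * 𝟙 (does (proj₂ uv ≟W concat K₀)))
      ≡⟨ cong ((sgn (length S₀) * sgn (length K₀)) *_) (∑-splits-𝟙-≟ bs (concat S₀) (concat K₀)) ⟩
    (sgn (length S₀) * sgn (length K₀)) * 𝟙 (does (bs ≟W (concat S₀ ++ concat K₀))) ∎
    where
    open ≡-Reasoning
    exchange : ∀ a b x → a * (b * x) ≡ x * (a * b)
    exchange = solve-∀
    regroup : ∀ a s c k → a * (s * (c * k)) ≡ (s * k) * (a * c)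
    regroup = solve-∀

  signedProductCount : Word n → Sentence n → Sentence n → ℤ
  signedProductCount bs K₀ S₀ = ∑ (compositions bs) (λ I → sgn (length bs ∸ length I) * ⁺ (prodCoeff I K₀ S₀))

  signedProductCount-eval : (bs : Word n) (K₀ S₀ : Sentence n) → T (allNonempty K₀) → T (allNonempty S₀) →
    signedProductCount bs K₀ S₀ ≡ sgn (length bs) * ((sgn (length S₀) * sgn (length K₀)) * 𝟙 (does (bs ≟W (concat S₀ ++ concat K₀))))
  signedProductCount-eval bs K₀ S₀ tK tS = begin
    ∑ (compositions bs) (λ I → sgn (length bs ∸ length I) * ⁺ (prodCoeff I K₀ S₀))
      ≡⟨ ∑-compositions-sound bs per-composition ⟩
    ∑ (compositions bs) (λ I → sgn (length bs) * (sgn (length I) * splitSum h h h I))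
      ≡⟨ ∑-*ˡ (compositions bs) (sgn (length bs)) _ ⟩
    sgn (length bs) * signedSplitSum bs h h h
      ≡⟨ cong (sgn (length bs) *_) (trans (signedSplitSum≡separatedSum bs h h h) (separatedSum-uniform bs h)) ⟩
    sgn (length bs) * splitsSum h bs
      ≡⟨ cong (sgn (length bs) *_) (splitsSum-indicator bs K₀ S₀ tK tS) ⟩
    sgn (length bs) * ((sgn (length S₀) * sgn (length K₀)) * 𝟙 (does (bs ≟W (concat S₀ ++ concat K₀)))) ∎
    where
    open ≡-Reasoning
    h = indicator K₀ S₀
    prodCoeff-splitSum : ∀ I → ⁺ (prodCoeff I K₀ S₀) ≡ splitSum h h h I
    prodCoeff-splitSum I = trans (𝟙-length-filterᵇ _ (allSplits I)) (∑-cong (allSplits I) (λ σ →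
      trans (𝟙-∧ (prefixes σ ≟S K₀) (suffixes σ ≟S S₀)) (sym (splitWeight-uniform h σ))))
    per-composition : ∀ I → IsComposition bs I →
      sgn (length bs ∸ length I) * ⁺ (prodCoeff I K₀ S₀) ≡ sgn (length bs) * (sgn (length I) * splitSum h h h I)
    per-composition I (e , t) = begin
      sgn (length bs ∸ length I) * ⁺ (prodCoeff I K₀ S₀)
        ≡⟨ cong₂ _*_ (sgn-∸ (length bs) (length I) (subst (length I ≤ℕ_) (cong length e) (length≤length-concat I t)))
                     (prodCoeff-splitSum I) ⟩
      sgn (length bs) * sgn (length I) * splitSum h h h I
        ≡⟨ ℤP.*-assoc (sgn (length bs)) (sgn (length I)) _ ⟩
      sgn (length bs) * (sgn (length I) * splitSum h h h I) ∎

  ∑-coarsenings-signedProductCount : (bs : Word n) (K Q : Sentence n) → T (allNonempty K) → T (allNonempty Q) →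
    ∑ (coarsenings Q) (signedProductCount bs K) ≡ sgn (length bs) * ((ι (length Q) * sgn (length K)) * 𝟙 (does (bs ≟W (concat Q ++ concat K))))
  ∑-coarsenings-signedProductCount bs K Q tK tQ = begin
    ∑ (coarsenings Q) (signedProductCount bs K)
      ≡⟨ ∑-map (map concat) (compositions Q) (signedProductCount bs K) ⟩
    ∑ (compositions Q) (λ C → signedProductCount bs K (map concat C))
      ≡⟨ ∑-compositions-sound Q per-composition ⟩
    ∑ (compositions Q) (λ C → sgn (length C) * β)
      ≡⟨ ∑-*ʳ (compositions Q) β (sgn ∘ length) ⟩
    ∑ (compositions Q) (sgn ∘ length) * β
      ≡⟨ cong (_* β) (∑-sgn-compositions Q) ⟩
    ι (length Q) * β
      ≡⟨ regroup (ι (length Q)) (sgn (length bs)) (sgn (length K)) _ ⟩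
    sgn (length bs) * ((ι (length Q) * sgn (length K)) * 𝟙 (does (bs ≟W (concat Q ++ concat K)))) ∎
    where
    open ≡-Reasoning
    β = sgn (length bs) * (sgn (length K) * 𝟙 (does (bs ≟W (concat Q ++ concat K))))
    regroup : ∀ i s k e → i * (s * (k * e)) ≡ s * ((i * k) * e)
    regroup = solve-∀
    regroup′ : ∀ s c k e → s * ((c * k) * e) ≡ c * (s * (k * e))
    regroup′ = solve-∀
    per-composition : ∀ C → IsComposition Q C → signedProductCount bs K (map concat C) ≡ sgn (length C) * β
    per-composition C (e , t) = begin
      signedProductCount bs K (map concat C)
        ≡⟨ signedProductCount-eval bs K (map concat C) tK (allNonempty-map-concat C (subst (T ∘ allNonempty) (sym e) tQ) t) ⟩
      sgn (length bs) * ((sgn (length (map concat C)) * sgn (length K)) * 𝟙 (does (bs ≟W (concat (map concat C) ++ concat K))))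
        ≡⟨ cong₂ (λ ℓ w → sgn (length bs) * ((sgn ℓ * sgn (length K)) * 𝟙 (does (bs ≟W (w ++ concat K)))))
             (LP.length-map concat C) (trans (LP.concat-concat C) (cong concat e)) ⟩
      sgn (length bs) * ((sgn (length C) * sgn (length K)) * 𝟙 (does (bs ≟W (concat Q ++ concat K))))
        ≡⟨ regroup′ (sgn (length bs)) (sgn (length C)) (sgn (length K)) _ ⟩
      sgn (length C) * β ∎

  ∑-revSentencesOf-signedProductCount : (bs u : Word n) (K : Sentence n) → T (allNonempty K) →
    ∑ (revSentencesOf u) (λ Q → sgn (length Q) * ∑ (coarsenings Q) (signedProductCount bs K))
      ≡ sgn (length bs) * (sgn (length K) * 𝟙 (does (bs ≟W (u ++ concat K))))
  ∑-revSentencesOf-signedProductCount bs u K tK = begin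
    ∑ (revSentencesOf u) (λ Q → sgn (length Q) * ∑ (coarsenings Q) (signedProductCount bs K))
      ≡⟨ ∑-map reverse (compositions u) _ ⟩
    ∑ (compositions u) (λ C → sgn (length (reverse C)) * ∑ (coarsenings (reverse C)) (signedProductCount bs K))
      ≡⟨ ∑-compositions-sound u (λ C valid → cong (sgn (length (reverse C)) *_)
           (∑-coarsenings-signedProductCount bs K (reverse C) tK (allNonempty-reverse C (proj₂ valid)))) ⟩
    ∑ (compositions u) ψ
      ≡⟨ ∑-compositions-atMostOneBlock u ψ (λ c₁ c₂ cs → several-blocks (c₁ ∷ c₂ ∷ cs) (LP.length-reverse (c₁ ∷ c₂ ∷ cs))) ⟩
    ψ (atMostOneBlock u)
      ≡⟨ one-block u ⟩
    sgn (length bs) * (sgn (length K) * 𝟙 (does (bs ≟W (u ++ concat K)))) ∎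
    where
    open ≡-Reasoning
    ψ : Sentence n → ℤ
    ψ C = sgn (length (reverse C)) * (sgn (length bs) * ((ι (length (reverse C)) * sgn (length K)) * 𝟙 (does (bs ≟W (concat (reverse C) ++ concat K)))))
    vanish : ∀ s t k e → s * (t * ((0ℤ * k) * e)) ≡ 0ℤ
    vanish = solve-∀
    several-blocks : ∀ C {m} → length (reverse C) ≡ suc (suc m) → ψ C ≡ 0ℤ
    several-blocks C ℓ≡ = trans (cong (λ ℓ → sgn (length (reverse C)) * (sgn (length bs) * ((ι ℓ * sgn (length K)) * e))) ℓ≡)
      (vanish (sgn (length (reverse C))) (sgn (length bs)) (sgn (length K)) e)
      where
      e = 𝟙 (does (bs ≟W (concat (reverse C) ++ concat K)))
    one-block : ∀ u → ψ (atMostOneBlock u) ≡ sgn (length bs) * (sgn (length K) * 𝟙 (does (bs ≟W (u ++ concat K))))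
    one-block []       = simplify (sgn (length bs)) (sgn (length K)) _
      where
      simplify : ∀ s k e → 1ℤ * (s * ((1ℤ * k) * e)) ≡ s * (k * e)
      simplify = solve-∀
    one-block (x ∷ xs) =
      trans (cong (λ w → -1ℤ * (sgn (length bs) * ((-1ℤ * sgn (length K)) * 𝟙 (does (bs ≟W (w ++ concat K)))))) (LP.++-identityʳ (x ∷ xs)))
            (simplify (sgn (length bs)) (sgn (length K)) _)
      where
      simplify : ∀ s k e → -1ℤ * (s * ((-1ℤ * k) * e)) ≡ s * (k * e)
      simplify = solve-∀

  tailEntry : Sentence n → Word n → Sentence n → ℤ
  tailEntry I u K = ∑ (revSentencesOf u) (λ Q → sgn (length Q) * ∑ (coarsenings Q) (λ S → MperpEntry S I K))

  𝔹Entry-[] : (D : ℕ) (v : Word n) (I : Sentence n) → 𝔹Entry D v I [] ≡ 0ℤ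
  𝔹Entry-[] D v I = ∑-vanishes (upTo (suc D)) _ λ L → ∑-vanishes (wordsOfLength L) _ λ u →
    ∑-vanishes (revSentencesOf u) _ λ Q → ℤP.*-zeroʳ (sgn (length Q))

  𝔹Entry-[]∷ : (D : ℕ) (a : Fin n) (I K : Sentence n) → 𝔹Entry D [ a ] I ([] ∷ K) ≡ 0ℤ
  𝔹Entry-[]∷ D a I K = ∑-vanishes (upTo (suc D)) _ λ L → ∑-vanishes (wordsOfLength L) _ λ u →
    ∑-vanishes (revSentencesOf u) _ λ Q → ℤP.*-zeroʳ (sgn (length Q))

  𝔹Entry-∷ : (D : ℕ) (a c : Fin n) (u : Word n) (I K : Sentence n) →
    𝔹Entry D [ a ] I ((c ∷ u) ∷ K) ≡ 𝟙 (does (a Fin.≟ c)) * (𝟙 (length u <ᵇ suc D) * tailEntry I u K)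
  𝔹Entry-∷ D a c u I K = begin
    𝔹Entry D [ a ] I ((c ∷ u) ∷ K)
      ≡⟨ ∑-cong (upTo (suc D)) (λ L → ∑-cong (wordsOfLength L) λ u′ → trans (∑-cong (revSentencesOf u′) (λ Q →
           trans (cong (sgn (length Q) *_) (trans (onlyIf-𝟙 (does (a Fin.≟ c) ∧ does (u′ ≟W u)) (X Q))
                                                 (cong (_* X Q) (𝟙-∧ (does (a Fin.≟ c)) (does (u′ ≟W u))))))
                 (exchange (sgn (length Q)) (𝟙 (does (a Fin.≟ c))) (𝟙 (does (u′ ≟W u))) (X Q))))
           (∑-*ˡ (revSentencesOf u′) (𝟙 (does (a Fin.≟ c)) * 𝟙 (does (u′ ≟W u))) (λ Q → sgn (length Q) * X Q))) ⟩
    ∑ (upTo (suc D)) (λ L → ∑ (wordsOfLength L) (λ u′ → 𝟙 (does (a Fin.≟ c)) * 𝟙 (does (u′ ≟W u)) * tailEntry I u′ K))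
      ≡⟨ ∑-cong (upTo (suc D)) (λ L → trans (∑-cong (wordsOfLength L) (λ u′ → ℤP.*-assoc (𝟙 (does (a Fin.≟ c))) _ _))
           (∑-*ˡ (wordsOfLength L) (𝟙 (does (a Fin.≟ c))) (λ u′ → 𝟙 (does (u′ ≟W u)) * tailEntry I u′ K))) ⟩
    ∑ (upTo (suc D)) (λ L → 𝟙 (does (a Fin.≟ c)) * ∑ (wordsOfLength L) (λ u′ → 𝟙 (does (u′ ≟W u)) * tailEntry I u′ K))
      ≡⟨ ∑-*ˡ (upTo (suc D)) (𝟙 (does (a Fin.≟ c))) _ ⟩
    𝟙 (does (a Fin.≟ c)) * ∑ (upTo (suc D)) (λ L → ∑ (wordsOfLength L) (λ u′ → 𝟙 (does (u′ ≟W u)) * tailEntry I u′ K))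
      ≡⟨ cong (𝟙 (does (a Fin.≟ c)) *_) (∑-wordsUpTo-𝟙-≟ D u (λ u′ → tailEntry I u′ K)) ⟩
    𝟙 (does (a Fin.≟ c)) * (𝟙 (length u <ᵇ suc D) * tailEntry I u K) ∎
    where
    open ≡-Reasoning
    X : Sentence n → ℤ
    X Q = ∑ (coarsenings Q) (λ S → MperpEntry S I K)
    exchange : ∀ s p q x → s * (p * q * x) ≡ p * q * (s * x)
    exchange = solve-∀

  MperpEntry-eval : (S I K : Sentence n) →
    MperpEntry S I K ≡ (𝟙 (allNonempty K) * 𝟙 (size K <ᵇ suc (size I))) * ⁺ (prodCoeff I K S)
  MperpEntry-eval S I K = begin
    MperpEntry S I K
      ≡⟨ ∑-cong (sentencesUpTo (size I)) (λ J → onlyIf-𝟙 (J ≟S K) (⁺ (prodCoeff I J S))) ⟩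
    ∑ (sentencesUpTo (size I)) (λ J → 𝟙 (does (J ≟SS K)) * ⁺ (prodCoeff I J S))
      ≡⟨ ∑-𝟙-≟S (sentencesUpTo (size I)) K (λ J → ⁺ (prodCoeff I J S)) ⟩
    countS (sentencesUpTo (size I)) K * ⁺ (prodCoeff I K S)
      ≡⟨ cong (_* ⁺ (prodCoeff I K S)) (count-sentencesUpTo (size I) K) ⟩
    (𝟙 (allNonempty K) * 𝟙 (size K <ᵇ suc (size I))) * ⁺ (prodCoeff I K S) ∎
    where open ≡-Reasoning

  ∑-signed-tailEntry : (bs u : Word n) (K : Sentence n) →
    ∑ (compositions bs) (λ I → sgn (length bs ∸ length I) * tailEntry I u K)
      ≡ 𝟙 (allNonempty K) * (𝟙 (size K <ᵇ suc (length bs)) * (sgn (length bs) * (sgn (length K) * 𝟙 (does (bs ≟W (u ++ concat K))))))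
  ∑-signed-tailEntry bs u K = begin
    ∑ (compositions bs) (λ I → sgn (length bs ∸ length I) * tailEntry I u K)
      ≡⟨ ∑-compositions-sound bs (λ I valid → cong (sgn (length bs ∸ length I) *_) (tailEntry-eval I valid)) ⟩
    ∑ (compositions bs) (λ I → sgn (length bs ∸ length I) * (κ * ∑ (revSentencesOf u) (λ Q → sgn (length Q) * ∑ (coarsenings Q) (p I))))
      ≡⟨ trans (∑-cong (compositions bs) (λ I → x∙yz≈y∙xz (sgn (length bs ∸ length I)) κ _)) (∑-*ˡ (compositions bs) κ _) ⟩
    κ * ∑ (compositions bs) (λ I → sgn (length bs ∸ length I) * ∑ (revSentencesOf u) (λ Q → sgn (length Q) * ∑ (coarsenings Q) (p I)))
      ≡⟨ cong (κ *_) (∑-*-swap (compositions bs) (revSentencesOf u) signI (sgn ∘ length) (λ I Q → ∑ (coarsenings Q) (p I))) ⟩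
    κ * ∑ (revSentencesOf u) (λ Q → sgn (length Q) * ∑ (compositions bs) (λ I → sgn (length bs ∸ length I) * ∑ (coarsenings Q) (p I)))
      ≡⟨ cong (κ *_) (∑-cong (revSentencesOf u) λ Q → cong (sgn (length Q) *_) (∑-*-∑ (compositions bs) (coarsenings Q) signI p)) ⟩
    κ * ∑ (revSentencesOf u) (λ Q → sgn (length Q) * ∑ (coarsenings Q) (signedProductCount bs K))
      ≡⟨ trans (ℤP.*-assoc (𝟙 (allNonempty K)) _ _) (cong (𝟙 (allNonempty K) *_) (cong (𝟙 (size K <ᵇ suc (length bs)) *_)
           (sym (ℤP.*-identityˡ _)))) ⟩
    𝟙 (allNonempty K) * (𝟙 (size K <ᵇ suc (length bs)) * (1ℤ * ∑ (revSentencesOf u) (λ Q → sgn (length Q) * ∑ (coarsenings Q) (signedProductCount bs K))))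
      ≡⟨ 𝟙-guard (allNonempty K) (λ t → cong (𝟙 (size K <ᵇ suc (length bs)) *_)
           (trans (ℤP.*-identityˡ _) (∑-revSentencesOf-signedProductCount bs u K t))) ⟩
    𝟙 (allNonempty K) * (𝟙 (size K <ᵇ suc (length bs)) * (sgn (length bs) * (sgn (length K) * 𝟙 (does (bs ≟W (u ++ concat K)))))) ∎
    where
    open ≡-Reasoning
    κ = 𝟙 (allNonempty K) * 𝟙 (size K <ᵇ suc (length bs))
    signI : Sentence n → ℤ
    signI I = sgn (length bs ∸ length I)
    p : Sentence n → Sentence n → ℤ
    p I S = ⁺ (prodCoeff I K S)
    tailEntry-eval : ∀ I → IsComposition bs I → tailEntry I u K ≡ κ * ∑ (revSentencesOf u) (λ Q → sgn (length Q) * ∑ (coarsenings Q) (p I))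
    tailEntry-eval I (e , _) = begin
      tailEntry I u K
        ≡⟨ ∑-cong (revSentencesOf u) (λ Q → cong (sgn (length Q) *_) (∑-cong (coarsenings Q) λ S →
             trans (MperpEntry-eval S I K) (cong (λ m → 𝟙 (allNonempty K) * 𝟙 (size K <ᵇ suc m) * p I S)
                                                 (trans (sym (length-concat I)) (cong length e))))) ⟩
      ∑ (revSentencesOf u) (λ Q → sgn (length Q) * ∑ (coarsenings Q) (λ S → κ * p I S))
        ≡⟨ ∑-∑-*ˡ (revSentencesOf u) coarsenings (sgn ∘ length) κ (p I) ⟩
      κ * ∑ (revSentencesOf u) (λ Q → sgn (length Q) * ∑ (coarsenings Q) (p I)) ∎

  𝟙-bookkeeping : ∀ d l v k e (s s′ σ : ℤ) → (T v → T e → (𝟙 l ≡ 1ℤ) × (𝟙 k ≡ 1ℤ) × (σ ≡ s * s′)) →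
    𝟙 d * (𝟙 l * (𝟙 v * (𝟙 k * (s * (s′ * 𝟙 e))))) ≡ 𝟙 (v ∧ (d ∧ e)) * σ
  𝟙-bookkeeping d     l false k e     s s′ σ h = vanish (𝟙 d) (𝟙 l) (𝟙 k * (s * (s′ * 𝟙 e))) σ
    where
    vanish : ∀ a b c x → a * (b * (0ℤ * c)) ≡ 0ℤ * x
    vanish = solve-∀
  𝟙-bookkeeping false l true  k e     s s′ σ h = ℤP.*-zeroˡ (𝟙 l * (1ℤ * (𝟙 k * (s * (s′ * 𝟙 e)))))
  𝟙-bookkeeping true  l true  k false s s′ σ h = vanish (𝟙 l) (𝟙 k) s s′ σ
    where
    vanish : ∀ a b s s′ x → 1ℤ * (a * (1ℤ * (b * (s * (s′ * 0ℤ))))) ≡ 0ℤ * x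
    vanish = solve-∀
  𝟙-bookkeeping true  l true  k true  s s′ σ h with h tt tt
  ... | l≡1 , k≡1 , σ≡ss′ = trans (cong₂ (λ x y → 1ℤ * (x * (1ℤ * (y * (s * (s′ * 1ℤ)))))) l≡1 k≡1)
                                  (trans (simplify s s′) (cong (1ℤ *_) (sym σ≡ss′)))
    where
    simplify : ∀ s s′ → 1ℤ * (1ℤ * (1ℤ * (1ℤ * (s * (s′ * 1ℤ))))) ≡ 1ℤ * (s * s′)
    simplify = solve-∀

  ∑-signed-𝔹Entry : (D : ℕ) (a : Fin n) (bs : Word n) (K : Sentence n) → length bs ≤ℕ D →
    ∑ (compositions bs) (λ I → sgn (length bs ∸ length I) * 𝔹Entry D [ a ] I K)
      ≡ 𝟙 (allNonempty K ∧ does ((a ∷ bs) ≟W concat K)) * sgn (suc (length bs) ∸ length K)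
  ∑-signed-𝔹Entry D a bs []                 _ = ∑-vanishes (compositions bs) _ (λ I →
    trans (cong (sgn (length bs ∸ length I) *_) (𝔹Entry-[] D [ a ] I)) (ℤP.*-zeroʳ (sgn (length bs ∸ length I))))
  ∑-signed-𝔹Entry D a bs ([] ∷ K)           _ = ∑-vanishes (compositions bs) _ (λ I →
    trans (cong (sgn (length bs ∸ length I) *_) (𝔹Entry-[]∷ D a I K)) (ℤP.*-zeroʳ (sgn (length bs ∸ length I))))
  ∑-signed-𝔹Entry D a bs ((c ∷ u) ∷ K) bs≤D = begin
    ∑ (compositions bs) (λ I → sgn (length bs ∸ length I) * 𝔹Entry D [ a ] I ((c ∷ u) ∷ K))
      ≡⟨ ∑-cong (compositions bs) (λ I → trans (cong (sgn (length bs ∸ length I) *_) (𝔹Entry-∷ D a c u I K))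
           (exchange (sgn (length bs ∸ length I)) 𝟙a≟c 𝟙u≤D (tailEntry I u K))) ⟩
    ∑ (compositions bs) (λ I → (𝟙a≟c * 𝟙u≤D) * (sgn (length bs ∸ length I) * tailEntry I u K))
      ≡⟨ trans (∑-*ˡ (compositions bs) (𝟙a≟c * 𝟙u≤D) _) (ℤP.*-assoc 𝟙a≟c 𝟙u≤D _) ⟩
    𝟙a≟c * (𝟙u≤D * ∑ (compositions bs) (λ I → sgn (length bs ∸ length I) * tailEntry I u K))
      ≡⟨ cong (λ x → 𝟙a≟c * (𝟙u≤D * x)) (∑-signed-tailEntry bs u K) ⟩
    𝟙a≟c * (𝟙u≤D * (𝟙 (allNonempty K) * (𝟙 (size K <ᵇ suc (length bs)) * (sgn (length bs) * (sgn (length K) * 𝟙 (does (bs ≟W (u ++ concat K))))))))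
      ≡⟨ 𝟙-bookkeeping (does (a Fin.≟ c)) (length u <ᵇ suc D) (allNonempty K) (size K <ᵇ suc (length bs)) (does (bs ≟W (u ++ concat K)))
           (sgn (length bs)) (sgn (length K)) (sgn (length bs ∸ length K)) side-conditions ⟩
    𝟙 (allNonempty K ∧ (does (a Fin.≟ c) ∧ does (bs ≟W (u ++ concat K)))) * sgn (length bs ∸ length K) ∎
    where
    open ≡-Reasoning
    𝟙a≟c = 𝟙 (does (a Fin.≟ c))
    𝟙u≤D = 𝟙 (length u <ᵇ suc D)
    exchange : ∀ s p q x → s * (p * (q * x)) ≡ p * q * (s * x)
    exchange = solve-∀
    𝟙-≤ : ∀ {m k} → m ≤ℕ k → 𝟙 (m <ᵇ suc k) ≡ 1ℤ
    𝟙-≤ m≤k = 𝟙-T (ℕP.<⇒<ᵇ (ℕ.s≤s m≤k))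
    side-conditions : T (allNonempty K) → T (does (bs ≟W (u ++ concat K))) →
      (𝟙u≤D ≡ 1ℤ) × (𝟙 (size K <ᵇ suc (length bs)) ≡ 1ℤ) × (sgn (length bs ∸ length K) ≡ sgn (length bs) * sgn (length K))
    side-conditions valid e with bs ≟W (u ++ concat K)
    ... | yes refl =
      𝟙-≤ (ℕP.≤-trans (LP.length-++-≤ˡ u) bs≤D) ,
      𝟙-≤ (subst (_≤ℕ length (u ++ concat K)) (length-concat K) (LP.length-++-≤ʳ (concat K) {u})) ,
      sgn-∸ (length (u ++ concat K)) (length K) (ℕP.≤-trans (length≤length-concat K valid) (LP.length-++-≤ʳ (concat K) {u}))

  ∑-coeff : (f : NSym n) (φ : Sentence n → ℤ) (E : List (Sentence n)) → Unique E → All (λ t → proj₂ t ∈ E) f →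
    ∑ f (λ t → proj₁ t * φ (proj₂ t)) ≡ ∑ E (λ J → coeff f J * φ J)
  ∑-coeff f φ E !E f⊆E = sym (begin
    ∑ E (λ J → coeff f J * φ J)
      ≡⟨ ∑-cong E (λ J → trans (cong (_* φ J) (coeff-∑ f J)) (sym (∑-*ʳ f (φ J) (termCoeff J)))) ⟩
    ∑ E (λ J → ∑ f (λ t → termCoeff J t * φ J))
      ≡⟨ ∑-swap E f (λ J t → termCoeff J t * φ J) ⟩
    ∑ f (λ t → ∑ E (λ J → termCoeff J t * φ J))
      ≡⟨ ∑-cong-All (All.map (λ {t} → picks-out t) f⊆E) ⟩
    ∑ f (λ t → proj₁ t * φ (proj₂ t)) ∎)
    where
    open ≡-Reasoning
    exchange : ∀ b c x → b * c * x ≡ c * (b * x)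
    exchange = solve-∀
    picks-out : ∀ t → proj₂ t ∈ E → ∑ E (λ J → termCoeff J t * φ J) ≡ proj₁ t * φ (proj₂ t)
    picks-out t t∈E = begin
      ∑ E (λ J → termCoeff J t * φ J)
        ≡⟨ ∑-cong E (λ J → trans (cong (_* φ J) (onlyIf-𝟙 (proj₂ t ≟S J) (proj₁ t)))
             (trans (exchange (𝟙 (proj₂ t ≟S J)) (proj₁ t) (φ J)) (cong (λ b → proj₁ t * (𝟙 b * φ J)) (does-≟S-sym (proj₂ t) J)))) ⟩
      ∑ E (λ J → proj₁ t * (𝟙 (does (J ≟SS proj₂ t)) * φ J))
        ≡⟨ ∑-*ˡ E (proj₁ t) (λ J → 𝟙 (does (J ≟SS proj₂ t)) * φ J) ⟩
      proj₁ t * ∑ E (λ J → 𝟙 (does (J ≟SS proj₂ t)) * φ J)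
        ≡⟨ cong (proj₁ t *_) (trans (∑-𝟙-≟S E (proj₂ t) φ) (trans (cong (_* φ (proj₂ t)) (countS-unique !E t∈E)) (ℤP.*-identityˡ _))) ⟩
      proj₁ t * φ (proj₂ t) ∎

  ∑-coeff-cong : (f g : NSym n) (φ : Sentence n → ℤ) → (∀ K → coeff f K ≡ coeff g K) →
    ∑ f (λ t → proj₁ t * φ (proj₂ t)) ≡ ∑ g (λ t → proj₁ t * φ (proj₂ t))
  ∑-coeff-cong f g φ f≈g = begin
    ∑ f (λ t → proj₁ t * φ (proj₂ t))   ≡⟨ ∑-coeff f φ E !E (All.tabulate (∈-deduplicate⁺ _≟SS_ ∘ ∈-++⁺ˡ ∘ ∈-map⁺ proj₂)) ⟩
    ∑ E (λ J → coeff f J * φ J)         ≡⟨ ∑-cong E (λ J → cong (_* φ J) (f≈g J)) ⟩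
    ∑ E (λ J → coeff g J * φ J)         ≡⟨ ∑-coeff g φ E !E (All.tabulate (∈-deduplicate⁺ _≟SS_ ∘ ∈-++⁺ʳ (map proj₂ f) ∘ ∈-map⁺ proj₂)) ⟨
    ∑ g (λ t → proj₁ t * φ (proj₂ t))   ∎
    where
    open ≡-Reasoning
    E = deduplicate _≟SS_ (map proj₂ f ++ map proj₂ g)
    !E : Unique E
    !E = deduplicate-! _≟SS_ (map proj₂ f ++ map proj₂ g)

  HasMatrix-cong : {Φ : NSym n → NSym n} {m : Sentence n → Sentence n → ℤ} → HasMatrix Φ m →
    (f g : NSym n) → (∀ K → coeff f K ≡ coeff g K) → ∀ K → coeff (Φ f) K ≡ coeff (Φ g) K
  HasMatrix-cong {m = m} Φ-m f g f≈g K =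
    trans (Φ-m f K) (trans (∑-coeff-cong f g (λ I → m I K) f≈g) (sym (Φ-m g K)))

  Occurs : Sentence n → NSym n → Set
  Occurs J f = Any (λ t → proj₂ t ≡ J) f

  size≤deg : (f : NSym n) {J : Sentence n} → Occurs J f → size J ≤ℕ deg f
  size≤deg (t ∷ f) (here refl) = ℕP.m≤m⊔n (size (proj₂ t)) (deg f)
  size≤deg (t ∷ f) (there J∈f) = ℕP.≤-trans (size≤deg f J∈f) (ℕP.m≤n⊔m (size (proj₂ t)) (deg f))

  ∈-sentencesUpTo : (J : Sentence n) → T (allNonempty J) → J ∈ sentencesUpTo (size J)
  ∈-sentencesUpTo J valid = countS≢0⇒∈ (sentencesUpTo (size J)) J (λ count≡0 → 1≢0 (begin
    1ℤ                                                   ≡⟨ cong₂ _*_ (𝟙-T valid) (𝟙-T (ℕP.<⇒<ᵇ (ℕP.n<1+n (size J)))) ⟨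
    𝟙 (allNonempty J) * 𝟙 (size J <ᵇ suc (size J))      ≡⟨ count-sentencesUpTo (size J) J ⟨
    countS (sentencesUpTo (size J)) J                    ≡⟨ count≡0 ⟩
    0ℤ                                                   ∎))
    where
    open ≡-Reasoning
    1≢0 : 1ℤ ≢ 0ℤ
    1≢0 ()

  -- J is hit by the summand L = 0, u = [], Q = [], S = [] of 𝔹 v f, where M_∅^⊥ acts as the identity
  𝔹-occurs : (v : Word n) {J : Sentence n} (f : NSym n) → T (allNonempty J) → Occurs J f → Occurs (v ∷ J) (𝔹 v f)
  𝔹-occurs v {J} f valid J∈f =
    AnyP.++⁺ˡ (AnyP.++⁺ˡ (AnyP.++⁺ˡ (AnyP.map⁺ (AnyP.map⁺ (AnyP.++⁺ˡ (AnyP.concat⁺ (AnyP.map⁺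
      (Any.map (λ { {t} refl → AnyP.map⁺ (Any.map (cong₂ _∷_ (LP.++-identityʳ v) ∘ sym) (∈-sentencesUpTo J valid)) }) J∈f))))))))

  allNonempty-letters : (as : List (Fin n)) → T (allNonempty (letters as))
  allNonempty-letters []       = tt
  allNonempty-letters (a ∷ as) = allNonempty-letters as

  size-letters : (as : List (Fin n)) → size (letters as) ≡ length as
  size-letters []       = refl
  size-letters (a ∷ as) = cong suc (size-letters as)

  letters-occurs : (as : List (Fin n)) → Occurs (letters as) (immaculate (letters as))
  letters-occurs []       = here refl
  letters-occurs (a ∷ as) = 𝔹-occurs [ a ] (immaculate (letters as)) (allNonempty-letters as) (letters-occurs as)

  length≤deg-immaculate : (as : List (Fin n)) → length as ≤ℕ deg (immaculate (letters as))
  length≤deg-immaculate as = subst (_≤ℕ deg (immaculate (letters as))) (size-letters as) (size≤deg _ (letters-occurs as))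

  signedCoarsenings : List (Fin n) → NSym n
  signedCoarsenings as = map (λ J → (sgn (length as ∸ length J) , J)) (coarsenings (letters as))

  ∑-signedCoarsenings : (as : List (Fin n)) (φ : Sentence n → ℤ) →
    ∑ (signedCoarsenings as) (λ t → proj₁ t * φ (proj₂ t)) ≡ ∑ (compositions as) (λ J → sgn (length as ∸ length J) * φ J)
  ∑-signedCoarsenings as φ =
    trans (∑-map (λ J → (sgn (length as ∸ length J) , J)) (coarsenings (letters as)) (λ t → proj₁ t * φ (proj₂ t)))
          (cong (λ Js → ∑ Js (λ J → sgn (length as ∸ length J) * φ J)) (coarsenings-letters as))

  coeff-signedCoarsenings : (as : List (Fin n)) (K : Sentence n) →
    coeff (signedCoarsenings as) K ≡ 𝟙 (allNonempty K ∧ does (as ≟W concat K)) * sgn (length as ∸ length K)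
  coeff-signedCoarsenings as K = begin
    coeff (signedCoarsenings as) K
      ≡⟨ coeff-∑ (signedCoarsenings as) K ⟩
    ∑ (signedCoarsenings as) (termCoeff K)
      ≡⟨ ∑-cong (signedCoarsenings as) (λ t → trans (onlyIf-𝟙 (proj₂ t ≟S K) (proj₁ t)) (ℤP.*-comm _ (proj₁ t))) ⟩
    ∑ (signedCoarsenings as) (λ t → proj₁ t * 𝟙 (does (proj₂ t ≟SS K)))
      ≡⟨ ∑-signedCoarsenings as (λ J → 𝟙 (does (J ≟SS K))) ⟩
    ∑ (compositions as) (λ J → sgn (length as ∸ length J) * 𝟙 (does (J ≟SS K)))
      ≡⟨ ∑-cong (compositions as) (λ J → ℤP.*-comm (sgn (length as ∸ length J)) _) ⟩
    ∑ (compositions as) (λ J → 𝟙 (does (J ≟SS K)) * sgn (length as ∸ length J))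
      ≡⟨ ∑-𝟙-≟S (compositions as) K (λ J → sgn (length as ∸ length J)) ⟩
    countS (compositions as) K * sgn (length as ∸ length K)
      ≡⟨ cong (_* sgn (length as ∸ length K)) (count-compositions as K) ⟩
    𝟙 (allNonempty K ∧ does (as ≟W concat K)) * sgn (length as ∸ length K) ∎
    where open ≡-Reasoning

proposition5p17 : (n : ℕ) (as : List (Fin n)) (K : Sentence n) →
    coeff (immaculate (letters as)) K
      ≡ coeff (map (λ J → ((- ⁺ 1) ^ (length as ∸ length J) , J)) (coarsenings (letters as))) K
proposition5p17 n []       K = refl
proposition5p17 n (a ∷ as) K = begin
  coeff (𝔹≤ D [ a ] f) K
    ≡⟨ HasMatrix-cong {Φ = 𝔹≤ D [ a ]} (𝔹≤-matrix D [ a ]) f (signedCoarsenings as) (proposition5p17 n as) K ⟩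
  coeff (𝔹≤ D [ a ] (signedCoarsenings as)) K
    ≡⟨ 𝔹≤-matrix D [ a ] (signedCoarsenings as) K ⟩
  ∑ (signedCoarsenings as) (λ t → proj₁ t * 𝔹Entry D [ a ] (proj₂ t) K)
    ≡⟨ ∑-signedCoarsenings as (λ J → 𝔹Entry D [ a ] J K) ⟩
  ∑ (compositions as) (λ J → sgn (length as ∸ length J) * 𝔹Entry D [ a ] J K)
    ≡⟨ ∑-signed-𝔹Entry D a as K (length≤deg-immaculate as) ⟩
  𝟙 (allNonempty K ∧ does ((a ∷ as) ≟W concat K)) * sgn (suc (length as) ∸ length K)
    ≡⟨ coeff-signedCoarsenings (a ∷ as) K ⟨
  coeff (signedCoarsenings (a ∷ as)) K ∎
  where
  open ≡-Reasoning
  f = immaculate (letters as)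
  D = deg f
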